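{- For all integers $m,n\ge 1$, define $f_{m,n}\in\mathcal{H}$ by $$f_{m,n}=L_mL_n-\sum_{\substack{0\le i\le m-1\\0\le j\le n-1}}B_+^{\,m-i+n-j-2}\bigl(\bullet\,B_+(L_iL_j)\bigr)+\sum_{\substack{0\le i\le m-1\\0\le j\le n-1\\(i,j)\ne(0,0)}}B_+^{\,m-i+n-j-1}\bigl(\bullet\,L_iL_j\bigr),$$ where $L_0=\mathbb{I}$, $L_k=B_+^{\,k-1}(\bullet)$ is the ladder (chain) tree with $k$ vertices for $k\ge1$, and $B_+^{\,0}$ is the identity. Then $\rho(f_{m,n})=0$, i.e. the rooted tree map $\widetilde{f_{m,n}}$ is the zero map on $\mathfrak{H}$.
   Context: A rooted tree is a finite connected oriented simple graph with exactly one distinguished vertex (the root) having no incoming edges; trees are non-planar and considered up to isomorphism. A rooted forest is a finite commutative product (disjoint union) of rooted trees; the empty forest is $\mathbb{I}$; $\bullet$ is the one-vertex tree. $\mathcal{H}$ is the free commutative unital $\mathbb{Q}$-algebra generated by rooted trees. The grafting operator $B_+$ is the $\mathbb{Q}$-linear map with $B_+(\mathbb{I})=\bullet$ and $B_+(t_1\cdots t_n)$ = the tree obtained by joining the roots of $t_1,\dots,t_n$ to a new common root. The coproduct $\Delta$ is the algebra homomorphism with $\Delta(\mathbb{I})=\mathbb{I}\otimes\mathbb{I}$ and $\Delta(B_+(f))=B_+(f)\otimes\mathbb{I}+((\mathrm{id}\otimes B_+)\circ\Delta)(f)$. Let $\mathfrak{H}=\mathbb{Q}\langle x,y\rangle$.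 $R_w$ is right multiplication by $w$; $R_y^{ -1}$ removes a final $y$. Rooted tree maps: $\tilde{\mathbb{I}}=\mathrm{id}$; for a nonempty forest $f$, $\tilde f$ is the $\mathbb{Q}$-linear map on $\mathfrak{H}$ with: (I) $\tilde\bullet(x)=-\tilde\bullet(y)=xy$; (II) $\widetilde{B_+(f)}(x)=-\widetilde{B_+(f)}(y)=R_yR_{x+2y}R_y^{ -1}\tilde f(x)$; (III) $\tilde f(v)=\tilde g(\tilde h(v))$ for $v\in\{x,y\}$ if $f=gh$; (IV) $\tilde f(wv)=\sum_{(f)}\tilde f_1(w)\tilde f_2(v)$ for $w\in\mathfrak{H}$, $v\in\{x,y\}$, where $\Delta(f)=\sum_{(f)}f_1\otimes f_2$; $\tilde f(1)=0$ for nonempty $f$; extended linearly to $\mathcal{H}$. $\rho:\mathcal{H}\to\mathrm{End}(\mathfrak{H})$, $\rho(f)=\tilde f$. -}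

module Defs where

open import Data.Nat using (ℕ; zero; suc; _∸_; _≡ᵇ_) renaming (_+_ to _+ℕ_; _*_ to _*ℕ_)
open import Data.Bool using (Bool; true; false; _∧_; if_then_else_)
open import Data.List using (List; []; _∷_; _++_; map; concatMap; reverse; upTo; foldr)
open import Data.Product using (_×_; _,_)
open import Data.Rational using (ℚ; 0ℚ; 1ℚ; _+_; _*_; -_)
open import Data.Rational.Properties using () renaming (_≟_ to _≟ℚ_)
open import Relation.Binary.PropositionalEquality using (_≡_; refl)
open import Relation.Nullary using (Dec; yes; no)
import Data.List.Properties as LP

-- Forests are represented as lists (order is immaterial for everything
-- below: all functions are invariant under reordering / isomorphism).

mutual
  data Tree : Set where
    B₊ : Forest → Tree

  data Forest : Set where
    𝕀   : Forest
    _·_ : Tree → Forest → Forest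

infixr 5 _·_

● : Tree
● = B₊ 𝕀

_⊗F_ : Forest → Forest → Forest
𝕀 ⊗F g = g
(t · f) ⊗F g = t · (f ⊗F g)

mutual
  sizeT : Tree → ℕ
  sizeT (B₊ f) = suc (sizeF f)

  sizeF : Forest → ℕ
  sizeF 𝕀 = 0
  sizeF (t · f) = sizeT t +ℕ sizeF f

-- Coproduct Δ, as the list of terms f₁ ⊗ f₂ (all coefficients are 1)
mutual
  ΔT : Tree → List (Forest × Forest)
  ΔT (B₊ f) = (B₊ f · 𝕀 , 𝕀) ∷ map (λ { (a , b) → (a , B₊ b · 𝕀) }) (ΔF f)

  ΔF : Forest → List (Forest × Forest)
  ΔF 𝕀 = (𝕀 , 𝕀) ∷ []
  ΔF (t · f) =
    concatMap (λ { (a₁ , b₁) → map (λ { (a₂ , b₂) → (a₁ ⊗F a₂ , b₁ ⊗F b₂) }) (ΔF f) }) (ΔT t)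

ℋ : Set
ℋ = List (ℚ × Forest)

-- 𝔥 = ℚ⟨x,y⟩ : finite ℚ-linear combinations of words

data Letter : Set where
  X Y : Letter

_≟L_ : (a b : Letter) → Dec (a ≡ b)
X ≟L X = yes refl
X ≟L Y = no (λ ())
Y ≟L X = no (λ ())
Y ≟L Y = yes refl

Word : Set
Word = List Letter

Poly : Set
Poly = List (ℚ × Word)

coeff : Poly → Word → ℚ
coeff [] u = 0ℚ
coeff ((c , w) ∷ p) u with LP.≡-dec _≟L_ w u
... | yes _ = c + coeff p u
... | no  _ = coeff p u

IsZero : Poly → Set
IsZero p = ∀ u → coeff p u ≡ 0ℚ

one : Poly
one = (1ℚ , []) ∷ []

letter : Letter → Poly
letter v = (1ℚ , v ∷ []) ∷ []

scaleP : ℚ → Poly → Poly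
scaleP c = map (λ { (a , w) → (c * a , w) })

negP : Poly → Poly
negP = scaleP (- 1ℚ)

_*P_ : Poly → Poly → Poly
p *P q = concatMap (λ { (a , u) → map (λ { (b , v) → (a * b , u ++ v) }) q }) p

sumP : List Poly → Poly
sumP = foldr _++_ []

R-y : Poly → Poly
R-y p = p *P letter Y

R-x+2y : Poly → Poly
R-x+2y p = p *P ((1ℚ , X ∷ []) ∷ (1ℚ + 1ℚ , Y ∷ []) ∷ [])

-- R_y⁻¹ : remove a final y.  (Only applied to elements of 𝔥y; words not
-- ending in y are sent to 0 — this case never arises.)
dropLastY : Word → List Word
dropLastY w with reverse w
... | Y ∷ r = reverse r ∷ []
... | _     = []

R-y⁻¹ : Poly → Poly
R-y⁻¹ = concatMap (λ { (c , w) → map (λ u → (c , u)) (dropLastY w) })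

-- Rooted tree maps.  All functions carry a fuel argument n (structural
-- recursion); with enough fuel (see ρ below) they compute exactly the
-- maps defined by rules (I)–(IV).

mutual
  tmT : ℕ → Tree → Letter → Poly
  tmT zero _ _ = []
  tmT (suc n) (B₊ 𝕀) X = (1ℚ , X ∷ Y ∷ []) ∷ []
  tmT (suc n) (B₊ 𝕀) Y = negP ((1ℚ , X ∷ Y ∷ []) ∷ [])
  tmT (suc n) (B₊ (t · f)) X = R-y (R-x+2y (R-y⁻¹ (tmF n (t · f) X)))
  tmT (suc n) (B₊ (t · f)) Y = negP (R-y (R-x+2y (R-y⁻¹ (tmF n (t · f) X))))

  -- value of a forest map on a letter: rule (III), f = t·g ↦ t̃ ∘ g̃
  tmF : ℕ → Forest → Letter → Poly
  tmF zero _ _ = []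
  tmF (suc n) 𝕀 v = letter v
  tmF (suc n) (t · 𝕀) v = tmT n t v
  tmF (suc n) (t · (s · g)) v = applyW n (t · 𝕀) (tmF n (s · g) v)

  -- value on a reversed word (v ∷ rw stands for the word (reverse rw) v):
  -- rule (IV) and f̃(1)=0 for f ≠ 𝕀, 𝕀̃ = id
  tmW : ℕ → Forest → List Letter → Poly
  tmW n 𝕀 [] = one
  tmW n (t · f) [] = []
  tmW n f (v ∷ rw) =
    sumP (map (λ { (f₁ , f₂) → tmW n f₁ rw *P tmF n f₂ v }) (ΔF f))

  applyW : ℕ → Forest → Poly → Poly
  applyW n f [] = []
  applyW n f ((c , w) ∷ p) = scaleP c (tmW n f (reverse w)) ++ applyW n f p

forestMap : Forest → Poly → Poly
forestMap f = applyW (2 *ℕ sizeF f +ℕ 2) f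

ρ : ℋ → Poly → Poly
ρ [] p = []
ρ ((c , f) ∷ h) p = scaleP c (forestMap f p) ++ ρ h p

B₊^ : ℕ → Forest → Forest
B₊^ zero f = f
B₊^ (suc k) f = B₊ (B₊^ k f) · 𝕀

-- ladder L_k = B₊^k(𝕀)   (L_0 = 𝕀, L_k = B₊^{k-1}(●))
L : ℕ → Forest
L k = B₊^ k 𝕀

f[_,_] : ℕ → ℕ → ℋ
f[ m , n ] =
  (1ℚ , L m ⊗F L n)
  ∷ concatMap (λ i → map (λ j →
        (- 1ℚ , B₊^ ((m ∸ i) +ℕ (n ∸ j) ∸ 2) (● · B₊ (L i ⊗F L j) · 𝕀)))
      (upTo n)) (upTo m)
  ++ concatMap (λ i → concatMap (λ j →
        if (i ≡ᵇ 0) ∧ (j ≡ᵇ 0) then []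
        else (1ℚ , B₊^ ((m ∸ i) +ℕ (n ∸ j) ∸ 1) (● · (L i ⊗F L j))) ∷ [])
      (upTo n)) (upTo m)

-- A polynomial vanishes iff its pairing ⟦ p ⟧ G with every functional G : Word → ℚ vanishes, so the
-- tree maps are studied through their transposes, dual f G w = ⟦ f̃(w) ⟧ G.  On these, grafting acts by
-- the derivation rule (B₊g)~(u v) = (B₊g)~(u) v + ε(v) ψ(g̃(u x)), where ψ = R_y R_{x+2y} R_y⁻¹ and
-- ε(x) = 1, ε(y) = −1.  For U empty or a tree and any forest V, the six-term element
--   E(U,V) = B₊U·B₊V − B₊(U·B₊V) − B₊(B₊U·V) + B₊B₊(UV) − ●·B₊(UV) + B₊(●·UV)
-- sends both letters to 0; on x this is the operator identity
--   (B₊U)~ψ − ψŨψ − ψ(B₊U)~ + ψψŨ − ∂ψŨ + ψ∂Ũ = 0   (∂ = ●~),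
-- which follows from the derivation rule and two commutation relations between ψ and ∂.  Since
-- Δ E(U,V) = E(U,V) ⊗ 𝕀 + Σ U₁V₁ ⊗ E(U₂,V₂), induction on words puts E(U,V) in ker ρ, and ker ρ is
-- closed under B₊.  Finally f_{m,n} telescopes to Σ_{i<m, j<n} B₊^{(m−1−i)+(n−1−j)} E(L_i, L_j).

module Submission where

open import Defs
open import Data.Nat using (ℕ; zero; suc; _≤_; _<_; s≤s; z≤n; _≤′_; ≤′-refl; ≤′-step; _∸_; _≡ᵇ_)
  renaming (_+_ to _+ℕ_; _*_ to _*ℕ_)
import Data.Nat.Properties as ℕ
open import Algebra.Properties.CommutativeSemigroup ℕ.+-commutativeSemigroup
  using () renaming (interchange to +-interchange)
open import Data.Bool using (true; false; _∧_; if_then_else_)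
open import Data.Rational using (ℚ; 0ℚ; 1ℚ; _+_; _*_; -_; _-_)
import Data.Rational.Properties as ℚ
open import Data.Rational.Solver using (module +-*-Solver)
open +-*-Solver using (solve; _:=_; con; _:+_; _:*_; :-_; _:-_)
open import Data.List using (List; []; _∷_; _++_; [_]; _∷ʳ_; initLast; _∷ʳ′_; map; concatMap; reverse; upTo)
import Data.List.Properties as List
open import Data.List.Relation.Unary.All using (All; []; _∷_)
import Data.List.Relation.Unary.All as All
open import Data.List.Relation.Unary.All.Properties using (map⁺; concat⁺; ++⁺; all-upTo; applyUpTo⁺₂)
open import Data.Product using (_×_; _,_; proj₁; proj₂; ∃; ∃₂)
open import Function using (_∘_; _$_)
open import Relation.Binary.PropositionalEquality hiding ([_])
open import Relation.Nullary using (yes; no)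
open ≡-Reasoning

private variable
  A B : Set

∑ : List A → (A → ℚ) → ℚ
∑ [] f = 0ℚ
∑ (x ∷ xs) f = f x + ∑ xs f

∑-++ : ∀ (xs ys : List A) f → ∑ (xs ++ ys) f ≡ ∑ xs f + ∑ ys f
∑-++ [] ys f = sym (ℚ.+-identityˡ (∑ ys f))
∑-++ (x ∷ xs) ys f rewrite ∑-++ xs ys f = sym (ℚ.+-assoc (f x) (∑ xs f) (∑ ys f))

∑-map : ∀ (g : A → B) xs f → ∑ (map g xs) f ≡ ∑ xs (f ∘ g)
∑-map g [] f = refl
∑-map g (x ∷ xs) f = cong (f (g x) +_) (∑-map g xs f)

∑-concatMap : ∀ (g : A → List B) xs f → ∑ (concatMap g xs) f ≡ ∑ xs (λ x → ∑ (g x) f)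
∑-concatMap g [] f = refl
∑-concatMap g (x ∷ xs) f =
  trans (∑-++ (g x) (concatMap g xs) f) (cong (∑ (g x) f +_) (∑-concatMap g xs f))

∑-cong-All : ∀ {P : A → Set} {f g : A → ℚ} → (∀ {x} → P x → f x ≡ g x) →
             ∀ {xs} → All P xs → ∑ xs f ≡ ∑ xs g
∑-cong-All f≡g [] = refl
∑-cong-All f≡g (px ∷ pxs) = cong₂ _+_ (f≡g px) (∑-cong-All f≡g pxs)

∑-cong : ∀ xs {f g : A → ℚ} → f ≗ g → ∑ xs f ≡ ∑ xs g
∑-cong [] f≗g = refl
∑-cong (x ∷ xs) f≗g = cong₂ _+_ (f≗g x) (∑-cong xs f≗g)

∑-zero-All : ∀ {P : A → Set} {f : A → ℚ} → (∀ {x} → P x → f x ≡ 0ℚ) →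
             ∀ {xs} → All P xs → ∑ xs f ≡ 0ℚ
∑-zero-All f≡0 [] = refl
∑-zero-All f≡0 (px ∷ pxs) rewrite f≡0 px | ∑-zero-All f≡0 pxs = ℚ.+-identityʳ 0ℚ

∑-zero : ∀ xs {f : A → ℚ} → (∀ x → f x ≡ 0ℚ) → ∑ xs f ≡ 0ℚ
∑-zero [] f≡0 = refl
∑-zero (x ∷ xs) f≡0 rewrite f≡0 x | ∑-zero xs f≡0 = ℚ.+-identityʳ 0ℚ

∑-+ : ∀ xs (f g : A → ℚ) → ∑ xs (λ x → f x + g x) ≡ ∑ xs f + ∑ xs g
∑-+ [] f g = sym (ℚ.+-identityʳ 0ℚ)
∑-+ (x ∷ xs) f g rewrite ∑-+ xs f g =
  solve 4 (λ a b c d → (a :+ b) :+ (c :+ d) := (a :+ c) :+ (b :+ d)) refl (f x) (g x) (∑ xs f) (∑ xs g)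

∑-- : ∀ xs (f g : A → ℚ) → ∑ xs (λ x → f x - g x) ≡ ∑ xs f - ∑ xs g
∑-- [] f g = sym (ℚ.+-inverseʳ 0ℚ)
∑-- (x ∷ xs) f g rewrite ∑-- xs f g =
  solve 4 (λ a b c d → (a :- b) :+ (c :- d) := (a :+ c) :- (b :+ d)) refl (f x) (g x) (∑ xs f) (∑ xs g)

∑-* : ∀ xs a (f : A → ℚ) → ∑ xs (λ x → a * f x) ≡ a * ∑ xs f
∑-* [] a f = sym (ℚ.*-zeroʳ a)
∑-* (x ∷ xs) a f rewrite ∑-* xs a f = sym (ℚ.*-distribˡ-+ a (f x) (∑ xs f))

Functional : Set
Functional = Word → ℚ

⟦_⟧ : List (ℚ × A) → (A → ℚ) → ℚ
⟦ p ⟧ G = ∑ p (λ x → proj₁ x * G (proj₂ x))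

infixl 6 _⊕_ _⊖_
infixr 7 _⊛_
infixl 8 _◂_
infixr 8 _▸_

_⊕_ _⊖_ : (A → ℚ) → (A → ℚ) → A → ℚ
(G ⊕ H) w = G w + H w
(G ⊖ H) w = G w - H w

_⊛_ : ℚ → (A → ℚ) → A → ℚ
(a ⊛ G) w = a * G w

𝟘 : A → ℚ
𝟘 _ = 0ℚ

_◂_ : Functional → Word → Functional
(G ◂ s) u = G (u ++ s)

_▸_ : Word → Functional → Functional
(s ▸ G) u = G (s ++ u)

◂-◂ : ∀ G s t → G ◂ s ◂ t ≗ G ◂ (t ++ s)
◂-◂ G s t u = cong G (List.++-assoc u t s)

⟦⟧-cong : ∀ (p : List (ℚ × A)) {G H : A → ℚ} → G ≗ H → ⟦ p ⟧ G ≡ ⟦ p ⟧ H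
⟦⟧-cong [] G≗H = refl
⟦⟧-cong ((c , w) ∷ p) G≗H = cong₂ (λ a b → c * a + b) (G≗H w) (⟦⟧-cong p G≗H)

⟦⟧-⊕ : ∀ (p : List (ℚ × A)) G H → ⟦ p ⟧ (G ⊕ H) ≡ ⟦ p ⟧ G + ⟦ p ⟧ H
⟦⟧-⊕ [] G H = sym (ℚ.+-identityʳ 0ℚ)
⟦⟧-⊕ ((c , w) ∷ p) G H rewrite ⟦⟧-⊕ p G H =
  solve 5 (λ c g h a b → c :* (g :+ h) :+ (a :+ b) := (c :* g :+ a) :+ (c :* h :+ b))
    refl c (G w) (H w) (⟦ p ⟧ G) (⟦ p ⟧ H)

⟦⟧-⊖ : ∀ (p : List (ℚ × A)) G H → ⟦ p ⟧ (G ⊖ H) ≡ ⟦ p ⟧ G - ⟦ p ⟧ H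
⟦⟧-⊖ [] G H = sym (ℚ.+-inverseʳ 0ℚ)
⟦⟧-⊖ ((c , w) ∷ p) G H rewrite ⟦⟧-⊖ p G H =
  solve 5 (λ c g h a b → c :* (g :- h) :+ (a :- b) := (c :* g :+ a) :- (c :* h :+ b))
    refl c (G w) (H w) (⟦ p ⟧ G) (⟦ p ⟧ H)

⟦⟧-⊛ : ∀ (p : List (ℚ × A)) a G → ⟦ p ⟧ (a ⊛ G) ≡ a * ⟦ p ⟧ G
⟦⟧-⊛ [] a G = sym (ℚ.*-zeroʳ a)
⟦⟧-⊛ ((c , w) ∷ p) a G rewrite ⟦⟧-⊛ p a G =
  solve 4 (λ c a g x → c :* (a :* g) :+ a :* x := a :* (c :* g :+ x)) refl c a (G w) (⟦ p ⟧ G)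

⟦⟧-𝟘 : ∀ (p : List (ℚ × A)) → ⟦ p ⟧ 𝟘 ≡ 0ℚ
⟦⟧-𝟘 [] = refl
⟦⟧-𝟘 ((c , w) ∷ p) rewrite ⟦⟧-𝟘 p | ℚ.*-zeroʳ c = ℚ.+-identityʳ 0ℚ

⟦⟧-cong-All : ∀ {P : A → Set} {p : List (ℚ × A)} {G H} → All (P ∘ proj₂) p →
              (∀ {w} → P w → G w ≡ H w) → ⟦ p ⟧ G ≡ ⟦ p ⟧ H
⟦⟧-cong-All Pp G≡H = ∑-cong-All (λ {x} Pw → cong (proj₁ x *_) (G≡H Pw)) Pp

⟦⟧-vanishes : ∀ (p : List (ℚ × A)) {G} → G ≗ 𝟘 → ⟦ p ⟧ G ≡ 0ℚ
⟦⟧-vanishes p G≗𝟘 = trans (⟦⟧-cong p G≗𝟘) (⟦⟧-𝟘 p)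

⟦⟧-++ : ∀ (p q : List (ℚ × A)) G → ⟦ p ++ q ⟧ G ≡ ⟦ p ⟧ G + ⟦ q ⟧ G
⟦⟧-++ p q G = ∑-++ p q _

⟦⟧-scaleP : ∀ c p G → ⟦ scaleP c p ⟧ G ≡ c * ⟦ p ⟧ G
⟦⟧-scaleP c [] G = sym (ℚ.*-zeroʳ c)
⟦⟧-scaleP c ((a , w) ∷ p) G rewrite ⟦⟧-scaleP c p G =
  solve 4 (λ c a g x → c :* a :* g :+ c :* x := c :* (a :* g :+ x)) refl c a (G w) (⟦ p ⟧ G)

⟦⟧-negP : ∀ p G → ⟦ negP p ⟧ G ≡ - ⟦ p ⟧ G
⟦⟧-negP p G = trans (⟦⟧-scaleP (- 1ℚ) p G) (solve 1 (λ x → con (- 1ℚ) :* x := :- x) refl (⟦ p ⟧ G))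

-- Stated for any h agreeing with the anonymous function inside _*P_, which cannot be named.
⟦⟧-map-prepend : ∀ (h : ℚ × Word → ℚ × Word) a u → (∀ b v → h (b , v) ≡ (a * b , u ++ v)) →
                 ∀ q G → ⟦ map h q ⟧ G ≡ a * ⟦ q ⟧ (u ▸ G)
⟦⟧-map-prepend h a u h≡ [] G = sym (ℚ.*-zeroʳ a)
⟦⟧-map-prepend h a u h≡ ((b , v) ∷ q) G rewrite h≡ b v | ⟦⟧-map-prepend h a u h≡ q G =
  solve 4 (λ a b g x → a :* b :* g :+ a :* x := a :* (b :* g :+ x)) refl a b (G (u ++ v)) (⟦ q ⟧ (u ▸ G))

⟦⟧-*P : ∀ p q G → ⟦ p *P q ⟧ G ≡ ⟦ p ⟧ (λ u → ⟦ q ⟧ (u ▸ G))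
⟦⟧-*P [] q G = refl
⟦⟧-*P ((a , u) ∷ p) q G =
  trans (⟦⟧-++ (map _ q) (p *P q) G)
        (cong₂ _+_ (⟦⟧-map-prepend _ a u (λ b v → refl) q G) (⟦⟧-*P p q G))

δ : Word → Functional
δ u w with List.≡-dec _≟L_ w u
... | yes _ = 1ℚ
... | no _ = 0ℚ

coeff≡⟦⟧δ : ∀ p u → coeff p u ≡ ⟦ p ⟧ (δ u)
coeff≡⟦⟧δ [] u = refl
coeff≡⟦⟧δ ((c , w) ∷ p) u with List.≡-dec _≟L_ w u
... | yes _ = cong₂ _+_ (sym (ℚ.*-identityʳ c)) (coeff≡⟦⟧δ p u)
... | no _ = trans (coeff≡⟦⟧δ p u) (solve 2 (λ c x → x := c :* con 0ℚ :+ x) refl c (⟦ p ⟧ (δ u)))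

isZero-if-⟦⟧≡0 : ∀ p → (∀ G → ⟦ p ⟧ G ≡ 0ℚ) → IsZero p
isZero-if-⟦⟧≡0 p ⟦p⟧≡0 u = trans (coeff≡⟦⟧δ p u) (⟦p⟧≡0 (δ u))

⟦⟧-∑ : ∀ (p : List (ℚ × A)) (xs : List B) (F : B → A → ℚ) →
      ⟦ p ⟧ (λ w → ∑ xs (λ x → F x w)) ≡ ∑ xs (λ x → ⟦ p ⟧ (F x))
⟦⟧-∑ p [] F = ⟦⟧-𝟘 p
⟦⟧-∑ p (x ∷ xs) F = trans (⟦⟧-⊕ p (F x) _) (cong (⟦ p ⟧ (F x) +_) (⟦⟧-∑ p xs F))

⟦⟧-comm : ∀ (h : List (ℚ × A)) (p : List (ℚ × B)) (F : A → B → ℚ) →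
          ⟦ h ⟧ (λ a → ⟦ p ⟧ (F a)) ≡ ⟦ p ⟧ (λ b → ⟦ h ⟧ (λ a → F a b))
⟦⟧-comm h p F =
  sym (trans (⟦⟧-∑ p h (λ x b → proj₁ x * F (proj₂ x) b))
             (∑-cong h (λ x → ⟦⟧-⊛ p (proj₁ x) (F (proj₂ x)))))

-- The coproduct

⊗F-identityʳ : ∀ f → f ⊗F 𝕀 ≡ f
⊗F-identityʳ 𝕀 = refl
⊗F-identityʳ (t · f) = cong (t ·_) (⊗F-identityʳ f)

⊗F-assoc : ∀ f g h → (f ⊗F g) ⊗F h ≡ f ⊗F (g ⊗F h)
⊗F-assoc 𝕀 g h = refl
⊗F-assoc (t · f) g h = cong (t ·_) (⊗F-assoc f g h)

sizeF-⊗F : ∀ f g → sizeF (f ⊗F g) ≡ sizeF f +ℕ sizeF g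
sizeF-⊗F 𝕀 g = refl
sizeF-⊗F (t · f) g rewrite sizeF-⊗F f g = sym (ℕ.+-assoc (sizeT t) (sizeF f) (sizeF g))

_⊗²_ : Forest × Forest → Forest × Forest → Forest × Forest
(a , b) ⊗² (c , d) = (a ⊗F c , b ⊗F d)

SplitsSize : ℕ → Forest × Forest → Set
SplitsSize n (a , b) = sizeF a +ℕ sizeF b ≡ n

mutual
  ΔT-splitsSize : ∀ t → All (SplitsSize (sizeT t)) (ΔT t)
  ΔT-splitsSize (B₊ f) =
    trans (ℕ.+-identityʳ _) (ℕ.+-identityʳ _) ∷ map⁺ (All.map (λ {x} → grafted x) (ΔF-splitsSize f))
    where
    grafted : ∀ x → SplitsSize (sizeF f) x → SplitsSize (suc (sizeF f)) (proj₁ x , B₊ (proj₂ x) · 𝕀)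
    grafted (a , b) a+b≡f rewrite ℕ.+-identityʳ (sizeF b) | ℕ.+-suc (sizeF a) (sizeF b) = cong suc a+b≡f

  ΔF-splitsSize : ∀ f → All (SplitsSize (sizeF f)) (ΔF f)
  ΔF-splitsSize 𝕀 = refl ∷ []
  ΔF-splitsSize (t · f) =
    concat⁺ (map⁺ (All.map (λ {x} p → map⁺ (All.map (λ {y} → product x y p) (ΔF-splitsSize f))) (ΔT-splitsSize t)))
    where
    product : ∀ x y → SplitsSize (sizeT t) x → SplitsSize (sizeF f) y → SplitsSize (sizeT t +ℕ sizeF f) (x ⊗² y)
    product (a₁ , b₁) (a₂ , b₂) e₁ e₂ rewrite sizeF-⊗F a₁ a₂ | sizeF-⊗F b₁ b₂ | sym e₁ | sym e₂ =
      +-interchange (sizeF a₁) (sizeF a₂) (sizeF b₁) (sizeF b₂)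

∑-ΔF-⊗F : ∀ f g (h : Forest × Forest → ℚ) →
          ∑ (ΔF (f ⊗F g)) h ≡ ∑ (ΔF f) (λ x → ∑ (ΔF g) (λ y → h (x ⊗² y)))
∑-ΔF-⊗F 𝕀 g h = sym (ℚ.+-identityʳ _)
∑-ΔF-⊗F (t · f) g h = begin
  ∑ (ΔF (t · (f ⊗F g))) h
    ≡⟨ ∑-concatMap _ (ΔT t) h ⟩
  ∑ (ΔT t) (λ x → ∑ (map (x ⊗²_) (ΔF (f ⊗F g))) h)
    ≡⟨ ∑-cong (ΔT t) (λ x → trans (∑-map _ (ΔF (f ⊗F g)) h) (∑-ΔF-⊗F f g _)) ⟩
  ∑ (ΔT t) (λ x → ∑ (ΔF f) (λ y → ∑ (ΔF g) (λ z → h (x ⊗² (y ⊗² z)))))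
    ≡⟨ ∑-cong (ΔT t) (λ x → ∑-cong (ΔF f) (λ y → ∑-cong (ΔF g) (λ z → cong h (reassociate x y z)))) ⟩
  ∑ (ΔT t) (λ x → ∑ (ΔF f) (λ y → ∑ (ΔF g) (λ z → h ((x ⊗² y) ⊗² z))))
    ≡⟨ ∑-cong (ΔT t) (λ x → sym (∑-map _ (ΔF f) _)) ⟩
  ∑ (ΔT t) (λ x → ∑ (map (x ⊗²_) (ΔF f)) (λ y → ∑ (ΔF g) (λ z → h (y ⊗² z))))
    ≡⟨ ∑-concatMap _ (ΔT t) _ ⟨
  ∑ (ΔF (t · f)) (λ y → ∑ (ΔF g) (λ z → h (y ⊗² z))) ∎
  where
  reassociate : ∀ x y z → x ⊗² (y ⊗² z) ≡ (x ⊗² y) ⊗² z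
  reassociate (a , b) (c , d) (e , f) = sym (cong₂ _,_ (⊗F-assoc a c e) (⊗F-assoc b d f))

∑-ΔF-tree : ∀ t (h : Forest × Forest → ℚ) → ∑ (ΔF (t · 𝕀)) h ≡ ∑ (ΔT t) (λ x → h (x ⊗² (𝕀 , 𝕀)) + 0ℚ)
∑-ΔF-tree t h = ∑-concatMap _ (ΔT t) h

∑-ΔF-B₊ : ∀ g (h : Forest × Forest → ℚ) →
          ∑ (ΔF (B₊ g · 𝕀)) h ≡ h (B₊ g · 𝕀 , 𝕀) + ∑ (ΔF g) (λ y → h (proj₁ y , B₊ (proj₂ y) · 𝕀))
∑-ΔF-B₊ g h = begin
  ∑ (ΔF (B₊ g · 𝕀)) h
    ≡⟨ ∑-ΔF-tree (B₊ g) h ⟩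
  (h (B₊ g · 𝕀 , 𝕀) + 0ℚ) + ∑ (map _ (ΔF g)) (λ x → h (x ⊗² (𝕀 , 𝕀)) + 0ℚ)
    ≡⟨ cong ((h (B₊ g · 𝕀 , 𝕀) + 0ℚ) +_) (∑-map _ (ΔF g) _) ⟩
  (h (B₊ g · 𝕀 , 𝕀) + 0ℚ) + ∑ (ΔF g) (λ y → h (proj₁ y ⊗F 𝕀 , B₊ (proj₂ y) · 𝕀) + 0ℚ)
    ≡⟨ cong₂ _+_ (ℚ.+-identityʳ (h (B₊ g · 𝕀 , 𝕀))) (∑-cong (ΔF g) (λ y → trans (ℚ.+-identityʳ _)
         (cong (λ a → h (a , B₊ (proj₂ y) · 𝕀)) (⊗F-identityʳ (proj₁ y))))) ⟩
  h (B₊ g · 𝕀 , 𝕀) + ∑ (ΔF g) (λ y → h (proj₁ y , B₊ (proj₂ y) · 𝕀)) ∎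

counit : Forest → ℚ
counit 𝕀 = 1ℚ
counit (t · f) = 0ℚ

counit-⊗F : ∀ f g → counit (f ⊗F g) ≡ counit f * counit g
counit-⊗F 𝕀 g = sym (ℚ.*-identityˡ (counit g))
counit-⊗F (t · f) g = sym (ℚ.*-zeroˡ (counit g))

∑-ΔF-counitˡ : ∀ f (h : Forest → ℚ) → ∑ (ΔF f) (λ x → counit (proj₁ x) * h (proj₂ x)) ≡ h f
∑-ΔF-counitˡ 𝕀 h = trans (ℚ.+-identityʳ _) (ℚ.*-identityˡ (h 𝕀))
∑-ΔF-counitˡ (B₊ g · f) h = begin
  ∑ (ΔF ((B₊ g · 𝕀) ⊗F f)) (λ z → counit (proj₁ z) * h (proj₂ z))
    ≡⟨ ∑-ΔF-⊗F (B₊ g · 𝕀) f _ ⟩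
  ∑ (ΔF (B₊ g · 𝕀)) (λ x → ∑ (ΔF f) (λ y → counit (proj₁ x ⊗F proj₁ y) * h (proj₂ x ⊗F proj₂ y)))
    ≡⟨ ∑-cong (ΔF (B₊ g · 𝕀)) counit-f ⟩
  ∑ (ΔF (B₊ g · 𝕀)) (λ x → counit (proj₁ x) * h (proj₂ x ⊗F f))
    ≡⟨ ∑-ΔF-B₊ g (λ x → counit (proj₁ x) * h (proj₂ x ⊗F f)) ⟩
  0ℚ * h f + ∑ (ΔF g) (λ y → counit (proj₁ y) * h (B₊ (proj₂ y) · f))
    ≡⟨ cong₂ _+_ (ℚ.*-zeroˡ (h f)) (∑-ΔF-counitˡ g (λ b → h (B₊ b · f))) ⟩
  0ℚ + h (B₊ g · f)
    ≡⟨ ℚ.+-identityˡ _ ⟩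
  h (B₊ g · f) ∎
  where
  counit-f : ∀ x → ∑ (ΔF f) (λ y → counit (proj₁ x ⊗F proj₁ y) * h (proj₂ x ⊗F proj₂ y))
                   ≡ counit (proj₁ x) * h (proj₂ x ⊗F f)
  counit-f (a , b) = begin
    ∑ (ΔF f) (λ y → counit (a ⊗F proj₁ y) * h (b ⊗F proj₂ y))
      ≡⟨ ∑-cong (ΔF f) (λ y → trans (cong (_* h (b ⊗F proj₂ y)) (counit-⊗F a (proj₁ y)))
                                     (ℚ.*-assoc (counit a) (counit (proj₁ y)) _)) ⟩
    ∑ (ΔF f) (λ y → counit a * (counit (proj₁ y) * h (b ⊗F proj₂ y)))
      ≡⟨ ∑-* (ΔF f) (counit a) _ ⟩
    counit a * ∑ (ΔF f) (λ y → counit (proj₁ y) * h (b ⊗F proj₂ y))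
      ≡⟨ cong (counit a *_) (∑-ΔF-counitˡ f (λ c → h (b ⊗F c))) ⟩
    counit a * h (b ⊗F f) ∎

-- The forests U for which (U V)~(x) = Ũ(Ṽ(x)) is a single application of rule (III).
data TreeOrEmpty : Forest → Set where
  empty : TreeOrEmpty 𝕀
  tree  : ∀ t → TreeOrEmpty (t · 𝕀)

ΔF-TreeOrEmpty : ∀ {U} → TreeOrEmpty U → All (TreeOrEmpty ∘ proj₂) (ΔF U)
ΔF-TreeOrEmpty empty = empty ∷ []
ΔF-TreeOrEmpty (tree (B₊ g)) =
  concat⁺ ((empty ∷ []) ∷ map⁺ (map⁺ (All.universal (λ y → tree (B₊ (proj₂ y)) ∷ []) (ΔF g))))

-- Saturating the fuel of the tree maps

fuel : Forest → ℕ
fuel f = suc (2 *ℕ sizeF f)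

sizeT-positive : ∀ t → 1 ≤ sizeT t
sizeT-positive (B₊ f) = s≤s z≤n

fuel-after-tree : ∀ t f → fuel f ≤ 2 *ℕ sizeF (t · f)
fuel-after-tree t f rewrite ℕ.*-distribˡ-+ 2 (sizeT t) (sizeF f) =
  ℕ.+-monoˡ-≤ (2 *ℕ sizeF f) (ℕ.≤-trans (sizeT-positive t) (ℕ.m≤m+n (sizeT t) _))

fuel-before-forest : ∀ t s g → fuel (t · 𝕀) ≤ 2 *ℕ sizeF (t · s · g)
fuel-before-forest t s g rewrite ℕ.+-identityʳ (sizeT t) | ℕ.*-distribˡ-+ 2 (sizeT t) (sizeF (s · g))
                                | ℕ.+-comm 1 (2 *ℕ sizeT t) =
  ℕ.+-monoʳ-≤ (2 *ℕ sizeT t)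
              (ℕ.≤-trans (sizeT-positive s) (ℕ.≤-trans (ℕ.m≤m+n (sizeT s) (sizeF g)) (ℕ.m≤m+n _ _)))

eventually-constant : ∀ {A : Set} (a : ℕ → A) {m} → (∀ {n} → m ≤ n → a n ≡ a (suc n)) →
                      ∀ {n} → m ≤ n → a n ≡ a m
eventually-constant a {m} step m≤n = go (ℕ.≤⇒≤′ m≤n)
  where
  go : ∀ {n} → m ≤′ n → a n ≡ a m
  go ≤′-refl = refl
  go (≤′-step m≤′n) = trans (sym (step (ℕ.≤′⇒≤ m≤′n))) (go m≤′n)

tmW-∷ : ∀ n f v rw → tmW n f (v ∷ rw) ≡ sumP (map (λ x → tmW n (proj₁ x) rw *P tmF n (proj₂ x) v) (ΔF f))
tmW-∷ n 𝕀 v rw = refl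
tmW-∷ n (t · f) v rw = refl

TreeMapsStable ForestMapsStable : ℕ → Set
TreeMapsStable n = ∀ t v → 2 *ℕ sizeT t ≤ n → tmT n t v ≡ tmT (suc n) t v
ForestMapsStable n = ∀ f v → fuel f ≤ n → tmF n f v ≡ tmF (suc n) f v

tmW-stable : ∀ {n} → ForestMapsStable n → ∀ f rw → fuel f ≤ n → tmW n f rw ≡ tmW (suc n) f rw
tmW-stable stable 𝕀 [] _ = refl
tmW-stable stable (t · f) [] _ = refl
tmW-stable {n} stable f (v ∷ rw) f≤n =
  trans (tmW-∷ n f v rw)
        (trans (cong sumP (List.map-cong-local (All.map (λ {x} → factors x) (ΔF-splitsSize f))))
               (sym (tmW-∷ (suc n) f v rw)))
  where
  factors : ∀ x → SplitsSize (sizeF f) x →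
            tmW n (proj₁ x) rw *P tmF n (proj₂ x) v ≡ tmW (suc n) (proj₁ x) rw *P tmF (suc n) (proj₂ x) v
  factors (a , b) a+b≡f =
    cong₂ _*P_ (tmW-stable stable a rw (fits (ℕ.m≤m+n (sizeF a) (sizeF b))))
               (stable b v (fits (ℕ.m≤n+m (sizeF b) (sizeF a))))
    where
    fits : ∀ {c} → c ≤ sizeF a +ℕ sizeF b → suc (2 *ℕ c) ≤ n
    fits c≤ = ℕ.≤-trans (s≤s (ℕ.*-monoʳ-≤ 2 (ℕ.≤-trans c≤ (ℕ.≤-reflexive a+b≡f)))) f≤n

applyW-stable : ∀ {n} → ForestMapsStable n → ∀ f p → fuel f ≤ n → applyW n f p ≡ applyW (suc n) f p
applyW-stable stable f [] _ = refl
applyW-stable stable f ((c , w) ∷ p) f≤n =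
  cong₂ _++_ (cong (scaleP c) (tmW-stable stable f (reverse w) f≤n)) (applyW-stable stable f p f≤n)

tm-stable : ∀ n → TreeMapsStable n × ForestMapsStable n
tm-stable zero = (λ { (B₊ f) v () }) , (λ f v ())
tm-stable (suc n) = tree-stable , forest-stable
  where
  stable-n : ForestMapsStable n
  stable-n = proj₂ (tm-stable n)
  below : ∀ s → 2 *ℕ suc s ≤ suc n → suc (2 *ℕ s) ≤ n
  below s h = ℕ.≤-pred (subst (_≤ suc n) (ℕ.*-suc 2 s) h)
  tree-stable : TreeMapsStable (suc n)
  tree-stable (B₊ 𝕀) X _ = refl
  tree-stable (B₊ 𝕀) Y _ = refl
  tree-stable (B₊ (t · f)) X h = cong (R-y ∘ R-x+2y ∘ R-y⁻¹) (stable-n (t · f) X (below _ h))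
  tree-stable (B₊ (t · f)) Y h = cong (negP ∘ R-y ∘ R-x+2y ∘ R-y⁻¹) (stable-n (t · f) X (below _ h))
  forest-stable : ForestMapsStable (suc n)
  forest-stable 𝕀 v _ = refl
  forest-stable (t · 𝕀) v h =
    proj₁ (tm-stable n) t v (subst (λ k → 2 *ℕ k ≤ n) (ℕ.+-identityʳ (sizeT t)) (ℕ.≤-pred h))
  forest-stable (t · s · g) v h =
    trans (cong (applyW n (t · 𝕀)) (stable-n (s · g) v (ℕ.≤-trans (fuel-after-tree t (s · g)) (ℕ.≤-pred h))))
          (applyW-stable stable-n (t · 𝕀) (tmF (suc n) (s · g) v)
                         (ℕ.≤-trans (fuel-before-forest t s g) (ℕ.≤-pred h)))

letterImage : Forest → Letter → Poly
letterImage f = tmF (fuel f) f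

revWordImage : Forest → Word → Poly
revWordImage f = tmW (fuel f) f

image : Forest → Poly → Poly
image f = applyW (fuel f) f

tmF-saturated : ∀ {f n} v → fuel f ≤ n → tmF n f v ≡ letterImage f v
tmF-saturated {f} v = eventually-constant (λ n → tmF n f v) (λ {n} → proj₂ (tm-stable n) f v)

tmW-saturated : ∀ {f n} rw → fuel f ≤ n → tmW n f rw ≡ revWordImage f rw
tmW-saturated {f} rw =
  eventually-constant (λ n → tmW n f rw) (λ {n} → tmW-stable (proj₂ (tm-stable n)) f rw)

applyW-saturated : ∀ {f n} p → fuel f ≤ n → applyW n f p ≡ image f p
applyW-saturated {f} p =
  eventually-constant (λ n → applyW n f p) (λ {n} → applyW-stable (proj₂ (tm-stable n)) f p)

forestMap≡image : ∀ f p → forestMap f p ≡ image f p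
forestMap≡image f p = applyW-saturated p (ℕ.≤-trans (ℕ.n≤1+n _) (ℕ.≤-reflexive (ℕ.+-comm 2 (2 *ℕ sizeF f))))

⟦⟧-sumP-map : ∀ (xs : List A) (f : A → Poly) G → ⟦ sumP (map f xs) ⟧ G ≡ ∑ xs (λ x → ⟦ f x ⟧ G)
⟦⟧-sumP-map [] f G = refl
⟦⟧-sumP-map (x ∷ xs) f G = trans (⟦⟧-++ (f x) (sumP (map f xs)) G) (cong (⟦ f x ⟧ G +_) (⟦⟧-sumP-map xs f G))

⟦⟧-applyW : ∀ n f p G → ⟦ applyW n f p ⟧ G ≡ ⟦ p ⟧ (λ w → ⟦ tmW n f (reverse w) ⟧ G)
⟦⟧-applyW n f [] G = refl
⟦⟧-applyW n f ((c , w) ∷ p) G =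
  trans (⟦⟧-++ (scaleP c (tmW n f (reverse w))) (applyW n f p) G)
        (cong₂ _+_ (⟦⟧-scaleP c (tmW n f (reverse w)) G) (⟦⟧-applyW n f p G))

revWordImage-∷ : ∀ f v rw G → ⟦ revWordImage f (v ∷ rw) ⟧ G ≡
                 ∑ (ΔF f) (λ x → ⟦ revWordImage (proj₁ x) rw *P letterImage (proj₂ x) v ⟧ G)
revWordImage-∷ f v rw G = begin
  ⟦ revWordImage f (v ∷ rw) ⟧ G
    ≡⟨ cong (λ p → ⟦ p ⟧ G) (tmW-∷ (fuel f) f v rw) ⟩
  ⟦ sumP (map (λ x → tmW (fuel f) (proj₁ x) rw *P tmF (fuel f) (proj₂ x) v) (ΔF f)) ⟧ G
    ≡⟨ ⟦⟧-sumP-map (ΔF f) _ G ⟩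
  ∑ (ΔF f) (λ x → ⟦ tmW (fuel f) (proj₁ x) rw *P tmF (fuel f) (proj₂ x) v ⟧ G)
    ≡⟨ ∑-cong-All (λ {x} → saturate x) (ΔF-splitsSize f) ⟩
  ∑ (ΔF f) (λ x → ⟦ revWordImage (proj₁ x) rw *P letterImage (proj₂ x) v ⟧ G) ∎
  where
  saturate : ∀ x → SplitsSize (sizeF f) x →
             ⟦ tmW (fuel f) (proj₁ x) rw *P tmF (fuel f) (proj₂ x) v ⟧ G ≡
             ⟦ revWordImage (proj₁ x) rw *P letterImage (proj₂ x) v ⟧ G
  saturate (a , b) a+b≡f = cong (λ p → ⟦ p ⟧ G)
    (cong₂ _*P_ (tmW-saturated {a} rw (bound (ℕ.m≤m+n (sizeF a) (sizeF b))))
                (tmF-saturated {b} v (bound (ℕ.m≤n+m (sizeF b) (sizeF a)))))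
    where
    bound : ∀ {c} → c ≤ sizeF a +ℕ sizeF b → suc (2 *ℕ c) ≤ fuel f
    bound c≤ = s≤s (ℕ.*-monoʳ-≤ 2 (ℕ.≤-trans c≤ (ℕ.≤-reflexive a+b≡f)))

letterImage-composite : ∀ t s g v → letterImage (t · s · g) v ≡ image (t · 𝕀) (letterImage (s · g) v)
letterImage-composite t s g v =
  trans (cong (applyW n (t · 𝕀)) (tmF-saturated v (fuel-after-tree t (s · g))))
        (applyW-saturated (letterImage (s · g) v) (fuel-before-forest t s g))
  where
  n : ℕ
  n = 2 *ℕ sizeF (t · s · g)

EndsInY Nonempty : Word → Set
EndsInY w = ∃ λ u → w ≡ u ∷ʳ Y
Nonempty w = ∃₂ λ u a → w ≡ u ∷ʳ a

AllWords : (Word → Set) → Poly → Set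
AllWords P = All (P ∘ proj₂)

endsInY-++ : ∀ u {w} → EndsInY w → EndsInY (u ++ w)
endsInY-++ u (v , refl) = u ++ v , sym (List.++-assoc u v [ Y ])

nonempty-++ : ∀ u {w} → Nonempty w → Nonempty (u ++ w)
nonempty-++ u (v , a , refl) = u ++ v , a , sym (List.++-assoc u v [ a ])

endsInY⇒nonempty : ∀ {w} → EndsInY w → Nonempty w
endsInY⇒nonempty (u , w≡uY) = u , Y , w≡uY

allWords-scaleP : ∀ {P} c p → AllWords P p → AllWords P (scaleP c p)
allWords-scaleP c [] [] = []
allWords-scaleP c ((a , w) ∷ p) (pw ∷ pws) = pw ∷ allWords-scaleP c p pws

allWords-*P : ∀ {P} → (∀ u {w} → P w → P (u ++ w)) → ∀ p q → AllWords P q → AllWords P (p *P q)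
allWords-*P P-++ [] q Pq = []
allWords-*P {P} P-++ ((a , u) ∷ p) q Pq = ++⁺ (prepend q Pq) (allWords-*P P-++ p q Pq)
  where
  prepend : ∀ q → AllWords P q → AllWords P (map _ q)
  prepend [] [] = []
  prepend ((b , v) ∷ q) (pv ∷ pvs) = P-++ u pv ∷ prepend q pvs

allWords-sumP : ∀ {P} (ps : List Poly) → All (AllWords P) ps → AllWords P (sumP ps)
allWords-sumP [] [] = []
allWords-sumP (p ∷ ps) (Pp ∷ Pps) = ++⁺ Pp (allWords-sumP ps Pps)

endsInY-R-y : ∀ p → AllWords EndsInY (R-y p)
endsInY-R-y p = allWords-*P endsInY-++ p (letter Y) (([] , refl) ∷ [])

NonemptyImagesEndInY : ℕ → Set
NonemptyImagesEndInY n = ∀ t f v → AllWords EndsInY (tmF n (t · f) v)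

endsInY-tmW : ∀ {n} → NonemptyImagesEndInY n → ∀ f r → AllWords EndsInY (tmW n f (Y ∷ r))
endsInY-tmW {n} images f r rewrite tmW-∷ n f Y r =
  allWords-sumP _ (map⁺ (All.universal term (ΔF f)))
  where
  letterY : ∀ n → NonemptyImagesEndInY n → ∀ f → AllWords EndsInY (tmF n f Y)
  letterY zero _ 𝕀 = []
  letterY (suc _) _ 𝕀 = ([] , refl) ∷ []
  letterY n images (t · f) = images t f Y
  term : ∀ x → AllWords EndsInY (tmW n (proj₁ x) r *P tmF n (proj₂ x) Y)
  term x = allWords-*P endsInY-++ (tmW n (proj₁ x) r) (tmF n (proj₂ x) Y) (letterY n images (proj₂ x))

endsInY-applyW : ∀ {n} → NonemptyImagesEndInY n → ∀ f q → AllWords EndsInY q → AllWords EndsInY (applyW n f q)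
endsInY-applyW images f [] [] = []
endsInY-applyW images f ((c , w) ∷ q) ((u , refl) ∷ Pq) =
  ++⁺ (allWords-scaleP c _ (subst (AllWords EndsInY ∘ tmW _ f) (sym (List.reverse-++ u [ Y ]))
                                   (endsInY-tmW images f (reverse u))))
      (endsInY-applyW images f q Pq)

endsInY-tm : ∀ n → NonemptyImagesEndInY n
endsInY-tm zero t f v = []
endsInY-tm (suc n) (B₊ 𝕀) 𝕀 v = bullet n v
  where
  bullet : ∀ n v → AllWords EndsInY (tmT n (B₊ 𝕀) v)
  bullet zero v = []
  bullet (suc n) X = (X ∷ [] , refl) ∷ []
  bullet (suc n) Y = (X ∷ [] , refl) ∷ []
endsInY-tm (suc n) (B₊ (t · g)) 𝕀 v = grafted n v
  where
  grafted : ∀ n v → AllWords EndsInY (tmT n (B₊ (t · g)) v)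
  grafted zero v = []
  grafted (suc n) X = endsInY-R-y (R-x+2y (R-y⁻¹ (tmF n (t · g) X)))
  grafted (suc n) Y = allWords-scaleP (- 1ℚ) _ (endsInY-R-y (R-x+2y (R-y⁻¹ (tmF n (t · g) X))))
endsInY-tm (suc n) t (s · g) v = endsInY-applyW (endsInY-tm n) (t · 𝕀) (tmF n (s · g) v) (endsInY-tm n s g v)

letterImage-endsInY : ∀ t f v → AllWords EndsInY (letterImage (t · f) v)
letterImage-endsInY t f v = endsInY-tm (fuel (t · f)) t f v

letterImage-nonempty : ∀ f v → AllWords Nonempty (letterImage f v)
letterImage-nonempty 𝕀 v = ([] , v , refl) ∷ []
letterImage-nonempty (t · f) v = All.map endsInY⇒nonempty (letterImage-endsInY t f v)

2ℚ : ℚ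
2ℚ = 1ℚ + 1ℚ

sign : Letter → ℚ
sign X = 1ℚ
sign Y = - 1ℚ

ψᵀ-last : Functional → Word → Letter → ℚ
ψᵀ-last G u X = G (u ++ X ∷ Y ∷ [])
ψᵀ-last G u Y = G (u ++ X ∷ Y ∷ []) + 2ℚ * G (u ++ Y ∷ Y ∷ [])

ψᵀ-rev : Functional → List Letter → ℚ
ψᵀ-rev G [] = 0ℚ
ψᵀ-rev G (a ∷ r) = ψᵀ-last G (reverse r) a

-- ψᵀ is the transpose of ψ = R_y R_{x+2y} R_y⁻¹, extended to words ending in x by ψ(u x) = u x y.
ψᵀ : Functional → Functional
ψᵀ G w = ψᵀ-rev G (reverse w)

ψᵀ-∷ʳ : ∀ G u a → ψᵀ G (u ∷ʳ a) ≡ ψᵀ-last G u a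
ψᵀ-∷ʳ G u a rewrite List.reverse-++ u [ a ] | List.reverse-involutive u = refl

ψᵀ-▸ : ∀ u G {w} → Nonempty w → ψᵀ (u ▸ G) w ≡ (u ▸ ψᵀ G) w
ψᵀ-▸ u G (v , a , refl) rewrite ψᵀ-∷ʳ (u ▸ G) v a | sym (List.++-assoc u v [ a ]) | ψᵀ-∷ʳ G (u ++ v) a = last a
  where
  last : ∀ a → ψᵀ-last (u ▸ G) v a ≡ ψᵀ-last G (u ++ v) a
  last X = cong G (sym (List.++-assoc u v _))
  last Y = cong₂ (λ s t → G s + 2ℚ * G t) (sym (List.++-assoc u v _)) (sym (List.++-assoc u v _))

dropLastY-∷ʳY : ∀ u → dropLastY (u ∷ʳ Y) ≡ [ u ]
dropLastY-∷ʳY u = trans (drop (u ∷ʳ Y) (reverse u) (List.reverse-++ u [ Y ])) (cong [_] (List.reverse-involutive u))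
  where
  drop : ∀ w r → reverse w ≡ Y ∷ r → dropLastY w ≡ [ reverse r ]
  drop w r e with reverse w
  drop w r refl | .(Y ∷ r) = refl

⟦⟧-map-pair : ∀ c (ds : List Word) K → ⟦ map (λ u → (c , u)) ds ⟧ K ≡ c * ∑ ds K
⟦⟧-map-pair c [] K = sym (ℚ.*-zeroʳ c)
⟦⟧-map-pair c (d ∷ ds) K rewrite ⟦⟧-map-pair c ds K = sym (ℚ.*-distribˡ-+ c (K d) (∑ ds K))

⟦⟧-R-y⁻¹ : ∀ p K → ⟦ R-y⁻¹ p ⟧ K ≡ ⟦ p ⟧ (λ w → ∑ (dropLastY w) K)
⟦⟧-R-y⁻¹ [] K = refl
⟦⟧-R-y⁻¹ ((c , w) ∷ p) K =
  trans (⟦⟧-++ (map (λ u → (c , u)) (dropLastY w)) (R-y⁻¹ p) K)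
        (cong₂ _+_ (⟦⟧-map-pair c (dropLastY w) K) (⟦⟧-R-y⁻¹ p K))

⟦⟧-R-yR-x+2yR-y⁻¹ : ∀ p G → AllWords EndsInY p → ⟦ R-y (R-x+2y (R-y⁻¹ p)) ⟧ G ≡ ⟦ p ⟧ (ψᵀ G)
⟦⟧-R-yR-x+2yR-y⁻¹ p G p-endsInY =
  trans (⟦⟧-*P (R-x+2y (R-y⁻¹ p)) (letter Y) G)
        (trans (⟦⟧-*P (R-y⁻¹ p) _ (λ s → ⟦ letter Y ⟧ (s ▸ G)))
               (trans (⟦⟧-R-y⁻¹ p K) (⟦⟧-cong-All p-endsInY (λ {w} → on-word w))))
  where
  K : Functional
  K u = ⟦ (1ℚ , X ∷ []) ∷ (2ℚ , Y ∷ []) ∷ [] ⟧ (u ▸ (λ s → ⟦ letter Y ⟧ (s ▸ G)))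
  on-word : ∀ w → EndsInY w → ∑ (dropLastY w) K ≡ ψᵀ G w
  on-word w (u , refl) rewrite dropLastY-∷ʳY u | ψᵀ-∷ʳ G u Y =
    trans (cong₂ (λ s t → (1ℚ * (1ℚ * G s + 0ℚ) + (2ℚ * (1ℚ * G t + 0ℚ) + 0ℚ)) + 0ℚ)
                 (List.++-assoc u [ X ] [ Y ]) (List.++-assoc u [ Y ] [ Y ])) $
    solve 2 (λ a b → (con 1ℚ :* (con 1ℚ :* a :+ con 0ℚ) :+ (con 2ℚ :* (con 1ℚ :* b :+ con 0ℚ) :+ con 0ℚ)) :+ con 0ℚ
                     := a :+ con 2ℚ :* b) refl (G (u ++ X ∷ Y ∷ [])) (G (u ++ Y ∷ Y ∷ []))

letterImage-B₊ : ∀ g G → ⟦ letterImage (B₊ g · 𝕀) X ⟧ G ≡ ⟦ letterImage g X ⟧ (ψᵀ G)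
letterImage-B₊ 𝕀 G = refl
letterImage-B₊ (t · f) G =
  trans (cong (λ p → ⟦ p ⟧ G) (sym (tmF-saturated {B₊ (t · f) · 𝕀} X (ℕ.≤-reflexive fuel-B₊))))
        (⟦⟧-R-yR-x+2yR-y⁻¹ (letterImage (t · f) X) G (letterImage-endsInY t f X))
  where
  s : ℕ
  s = sizeF (t · f)
  fuel-B₊ : fuel (B₊ (t · f) · 𝕀) ≡ suc (suc (fuel (t · f)))
  fuel-B₊ = cong suc (trans (cong (2 *ℕ_) (ℕ.+-identityʳ (suc s))) (ℕ.*-suc 2 s))

tmT-Y : ∀ n t → tmT n t Y ≡ negP (tmT n t X)
tmT-Y zero t = refl
tmT-Y (suc n) (B₊ 𝕀) = refl
tmT-Y (suc n) (B₊ (t · f)) = refl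

tmF-Y : ∀ n t f G → ⟦ tmF n (t · f) Y ⟧ G ≡ - ⟦ tmF n (t · f) X ⟧ G
tmF-Y zero t f G = refl
tmF-Y (suc n) t 𝕀 G rewrite tmT-Y n t = ⟦⟧-negP (tmT n t X) G
tmF-Y (suc n) t (s · g) G =
  trans (⟦⟧-applyW n (t · 𝕀) (tmF n (s · g) Y) G)
        (trans (tmF-Y n s g _) (cong -_ (sym (⟦⟧-applyW n (t · 𝕀) (tmF n (s · g) X) G))))

letterImage-sign : ∀ t f v G → ⟦ letterImage (t · f) v ⟧ G ≡ sign v * ⟦ letterImage (t · f) X ⟧ G
letterImage-sign t f X G = sym (ℚ.*-identityˡ _)
letterImage-sign t f Y G =
  trans (tmF-Y (fuel (t · f)) t f G) (solve 1 (λ a → :- a := con (- 1ℚ) :* a) refl (⟦ letterImage (t · f) X ⟧ G))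

letterImage-B₊-*P : ∀ q b v G → ⟦ q *P letterImage (B₊ b · 𝕀) v ⟧ G ≡ sign v * ⟦ q *P letterImage b X ⟧ (ψᵀ G)
letterImage-B₊-*P q b v G = begin
  ⟦ q *P letterImage (B₊ b · 𝕀) v ⟧ G
    ≡⟨ ⟦⟧-*P q (letterImage (B₊ b · 𝕀) v) G ⟩
  ⟦ q ⟧ (λ u → ⟦ letterImage (B₊ b · 𝕀) v ⟧ (u ▸ G))
    ≡⟨ ⟦⟧-cong q on-letter ⟩
  ⟦ q ⟧ (sign v ⊛ (λ u → ⟦ letterImage b X ⟧ (u ▸ ψᵀ G)))
    ≡⟨ ⟦⟧-⊛ q (sign v) _ ⟩
  sign v * ⟦ q ⟧ (λ u → ⟦ letterImage b X ⟧ (u ▸ ψᵀ G))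
    ≡⟨ cong (sign v *_) (⟦⟧-*P q (letterImage b X) (ψᵀ G)) ⟨
  sign v * ⟦ q *P letterImage b X ⟧ (ψᵀ G) ∎
  where
  on-letter : ∀ u → ⟦ letterImage (B₊ b · 𝕀) v ⟧ (u ▸ G) ≡ sign v * ⟦ letterImage b X ⟧ (u ▸ ψᵀ G)
  on-letter u = begin
    ⟦ letterImage (B₊ b · 𝕀) v ⟧ (u ▸ G)
      ≡⟨ letterImage-sign (B₊ b) 𝕀 v (u ▸ G) ⟩
    sign v * ⟦ letterImage (B₊ b · 𝕀) X ⟧ (u ▸ G)
      ≡⟨ cong (sign v *_) (letterImage-B₊ b (u ▸ G)) ⟩
    sign v * ⟦ letterImage b X ⟧ (ψᵀ (u ▸ G))
      ≡⟨ cong (sign v *_) (⟦⟧-cong-All (letterImage-nonempty b X) (ψᵀ-▸ u G)) ⟩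
    sign v * ⟦ letterImage b X ⟧ (u ▸ ψᵀ G) ∎

dual : Forest → Functional → Functional
dual f G w = ⟦ revWordImage f (reverse w) ⟧ G

⟦⟧-image : ∀ f p G → ⟦ image f p ⟧ G ≡ ⟦ p ⟧ (dual f G)
⟦⟧-image f = ⟦⟧-applyW (fuel f) f

dual-∷ʳ : ∀ f G u v → dual f G (u ∷ʳ v) ≡ ⟦ revWordImage f (v ∷ reverse u) ⟧ G
dual-∷ʳ f G u v = cong (λ rw → ⟦ revWordImage f rw ⟧ G) (List.reverse-++ u [ v ])

dual-cong : ∀ f {G H} → G ≗ H → dual f G ≗ dual f H
dual-cong f G≗H w = ⟦⟧-cong (revWordImage f (reverse w)) G≗H

dual-⊕ : ∀ f G H → dual f (G ⊕ H) ≗ dual f G ⊕ dual f H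
dual-⊕ f G H w = ⟦⟧-⊕ (revWordImage f (reverse w)) G H

dual-⊖ : ∀ f G H → dual f (G ⊖ H) ≗ dual f G ⊖ dual f H
dual-⊖ f G H w = ⟦⟧-⊖ (revWordImage f (reverse w)) G H

dual-⊛ : ∀ f a G → dual f (a ⊛ G) ≗ a ⊛ dual f G
dual-⊛ f a G w = ⟦⟧-⊛ (revWordImage f (reverse w)) a G

⟦⟧-*P-letter : ∀ p v G → ⟦ p *P letter v ⟧ G ≡ ⟦ p ⟧ (G ◂ [ v ])
⟦⟧-*P-letter p v G = trans (⟦⟧-*P p (letter v) G) (⟦⟧-cong p (λ u → trans (ℚ.+-identityʳ _) (ℚ.*-identityˡ _)))

revWordImage-𝕀 : ∀ rw G → ⟦ revWordImage 𝕀 rw ⟧ G ≡ G (reverse rw)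
revWordImage-𝕀 [] G = trans (ℚ.+-identityʳ _) (ℚ.*-identityˡ (G []))
revWordImage-𝕀 (v ∷ rw) G = begin
  ⟦ revWordImage 𝕀 (v ∷ rw) ⟧ G
    ≡⟨ revWordImage-∷ 𝕀 v rw G ⟩
  ⟦ revWordImage 𝕀 rw *P letter v ⟧ G + 0ℚ
    ≡⟨ ℚ.+-identityʳ _ ⟩
  ⟦ revWordImage 𝕀 rw *P letter v ⟧ G
    ≡⟨ ⟦⟧-*P-letter (revWordImage 𝕀 rw) v G ⟩
  ⟦ revWordImage 𝕀 rw ⟧ (G ◂ [ v ])
    ≡⟨ revWordImage-𝕀 rw (G ◂ [ v ]) ⟩
  G (reverse rw ∷ʳ v)
    ≡⟨ cong G (List.unfold-reverse v rw) ⟨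
  G (reverse (v ∷ rw)) ∎

dual-𝕀 : ∀ G → dual 𝕀 G ≗ G
dual-𝕀 G w = trans (revWordImage-𝕀 (reverse w) G) (cong G (List.reverse-involutive w))

revWordImage-B₊ : ∀ g v rw G → ⟦ revWordImage (B₊ g · 𝕀) (v ∷ rw) ⟧ G ≡
                  ⟦ revWordImage (B₊ g · 𝕀) rw ⟧ (G ◂ [ v ]) + sign v * ⟦ revWordImage g (X ∷ rw) ⟧ (ψᵀ G)
revWordImage-B₊ g v rw G = begin
  ⟦ revWordImage (B₊ g · 𝕀) (v ∷ rw) ⟧ G
    ≡⟨ revWordImage-∷ (B₊ g · 𝕀) v rw G ⟩
  ∑ (ΔF (B₊ g · 𝕀)) term
    ≡⟨ ∑-ΔF-B₊ g term ⟩
  term (B₊ g · 𝕀 , 𝕀) + ∑ (ΔF g) (λ y → term (proj₁ y , B₊ (proj₂ y) · 𝕀))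
    ≡⟨ cong₂ _+_ appended (∑-cong (ΔF g) grafted) ⟩
  ⟦ revWordImage (B₊ g · 𝕀) rw ⟧ (G ◂ [ v ]) + ∑ (ΔF g) (λ y → sign v * termX y)
    ≡⟨ cong (⟦ revWordImage (B₊ g · 𝕀) rw ⟧ (G ◂ [ v ]) +_) (∑-* (ΔF g) (sign v) termX) ⟩
  ⟦ revWordImage (B₊ g · 𝕀) rw ⟧ (G ◂ [ v ]) + sign v * ∑ (ΔF g) termX
    ≡⟨ cong (λ z → ⟦ revWordImage (B₊ g · 𝕀) rw ⟧ (G ◂ [ v ]) + sign v * z) (revWordImage-∷ g X rw (ψᵀ G)) ⟨
  ⟦ revWordImage (B₊ g · 𝕀) rw ⟧ (G ◂ [ v ]) + sign v * ⟦ revWordImage g (X ∷ rw) ⟧ (ψᵀ G) ∎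
  where
  term termX : Forest × Forest → ℚ
  term x = ⟦ revWordImage (proj₁ x) rw *P letterImage (proj₂ x) v ⟧ G
  termX x = ⟦ revWordImage (proj₁ x) rw *P letterImage (proj₂ x) X ⟧ (ψᵀ G)
  appended : term (B₊ g · 𝕀 , 𝕀) ≡ ⟦ revWordImage (B₊ g · 𝕀) rw ⟧ (G ◂ [ v ])
  appended = ⟦⟧-*P-letter (revWordImage (B₊ g · 𝕀) rw) v G
  grafted : ∀ y → term (proj₁ y , B₊ (proj₂ y) · 𝕀) ≡ sign v * termX y
  grafted (a , b) = letterImage-B₊-*P (revWordImage a rw) b v G

dual-B₊-∷ʳ : ∀ g G u v → dual (B₊ g · 𝕀) G (u ∷ʳ v) ≡
             dual (B₊ g · 𝕀) (G ◂ [ v ]) u + sign v * dual g (ψᵀ G) (u ∷ʳ X)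
dual-B₊-∷ʳ g G u v =
  trans (dual-∷ʳ (B₊ g · 𝕀) G u v)
        (trans (revWordImage-B₊ g v (reverse u) G)
               (cong (λ z → dual (B₊ g · 𝕀) (G ◂ [ v ]) u + sign v * z) (sym (dual-∷ʳ g (ψᵀ G) u X))))

dual-B₊-++₂ : ∀ g G u a b → dual (B₊ g · 𝕀) G (u ++ a ∷ b ∷ []) ≡
              dual (B₊ g · 𝕀) (G ◂ (a ∷ b ∷ [])) u + sign a * dual g (ψᵀ (G ◂ [ b ])) (u ∷ʳ X)
              + sign b * dual g (ψᵀ G) (u ∷ʳ a ∷ʳ X)
dual-B₊-++₂ g G u a b = begin
  dual (B₊ g · 𝕀) G (u ++ a ∷ b ∷ [])
    ≡⟨ cong (dual (B₊ g · 𝕀) G) (List.++-assoc u [ a ] [ b ]) ⟨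
  dual (B₊ g · 𝕀) G (u ∷ʳ a ∷ʳ b)
    ≡⟨ dual-B₊-∷ʳ g G (u ∷ʳ a) b ⟩
  dual (B₊ g · 𝕀) (G ◂ [ b ]) (u ∷ʳ a) + sign b * dual g (ψᵀ G) (u ∷ʳ a ∷ʳ X)
    ≡⟨ cong (_+ sign b * dual g (ψᵀ G) (u ∷ʳ a ∷ʳ X)) (dual-B₊-∷ʳ g (G ◂ [ b ]) u a) ⟩
  dual (B₊ g · 𝕀) (G ◂ [ b ] ◂ [ a ]) u + sign a * dual g (ψᵀ (G ◂ [ b ])) (u ∷ʳ X)
    + sign b * dual g (ψᵀ G) (u ∷ʳ a ∷ʳ X)
    ≡⟨ cong (λ z → z + sign a * dual g (ψᵀ (G ◂ [ b ])) (u ∷ʳ X) + sign b * dual g (ψᵀ G) (u ∷ʳ a ∷ʳ X))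
            (dual-cong (B₊ g · 𝕀) (◂-◂ G [ b ] [ a ]) u) ⟩
  dual (B₊ g · 𝕀) (G ◂ (a ∷ b ∷ [])) u + sign a * dual g (ψᵀ (G ◂ [ b ])) (u ∷ʳ X)
    + sign b * dual g (ψᵀ G) (u ∷ʳ a ∷ʳ X) ∎

dual-∷ʳX+∷ʳY : ∀ {U} → TreeOrEmpty U → ∀ G u →
               dual U G (u ∷ʳ X) + dual U G (u ∷ʳ Y) ≡ dual U (G ◂ [ X ]) u + dual U (G ◂ [ Y ]) u
dual-∷ʳX+∷ʳY empty G u = sym (cong₂ _+_ (trans (dual-𝕀 _ u) (sym (dual-𝕀 G (u ∷ʳ X))))
                                        (trans (dual-𝕀 _ u) (sym (dual-𝕀 G (u ∷ʳ Y)))))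
dual-∷ʳX+∷ʳY (tree (B₊ g)) G u =
  trans (cong₂ _+_ (dual-B₊-∷ʳ g G u X) (dual-B₊-∷ʳ g G u Y))
        (solve 3 (λ a b z → (a :+ con 1ℚ :* z) :+ (b :+ con (- 1ℚ) :* z) := a :+ b) refl
               (dual (B₊ g · 𝕀) (G ◂ [ X ]) u) (dual (B₊ g · 𝕀) (G ◂ [ Y ]) u) (dual g (ψᵀ G) (u ∷ʳ X)))

revWordImage-[]-*P : ∀ a q G → ⟦ revWordImage a [] *P q ⟧ G ≡ counit a * ⟦ q ⟧ G
revWordImage-[]-*P 𝕀 q G = trans (⟦⟧-*P one q G) (ℚ.+-identityʳ _)
revWordImage-[]-*P (t · a) q G = sym (ℚ.*-zeroˡ (⟦ q ⟧ G))

revWordImage-letter : ∀ f v G → ⟦ revWordImage f [ v ] ⟧ G ≡ ⟦ letterImage f v ⟧ G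
revWordImage-letter f v G =
  trans (revWordImage-∷ f v [] G)
        (trans (∑-cong (ΔF f) (λ x → revWordImage-[]-*P (proj₁ x) (letterImage (proj₂ x) v) G))
               (∑-ΔF-counitˡ f (λ b → ⟦ letterImage b v ⟧ G)))

letterImage-⊗F : ∀ {U} → TreeOrEmpty U → ∀ V G → ⟦ letterImage (U ⊗F V) X ⟧ G ≡ ⟦ letterImage V X ⟧ (dual U G)
letterImage-⊗F empty V G = sym (⟦⟧-cong (letterImage V X) (dual-𝕀 G))
letterImage-⊗F (tree t) 𝕀 G = sym (trans (ℚ.+-identityʳ _) (trans (ℚ.*-identityˡ _) (revWordImage-letter (t · 𝕀) X G)))
letterImage-⊗F (tree t) (s · g) G =
  trans (cong (λ p → ⟦ p ⟧ G) (letterImage-composite t s g X)) (⟦⟧-image (t · 𝕀) (letterImage (s · g) X) G)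

VanishesOnNonempty : Functional → Set
VanishesOnNonempty H = ∀ {w} → Nonempty w → H w ≡ 0ℚ

dual-vanishesOnNonempty : ∀ f {H} → VanishesOnNonempty H → VanishesOnNonempty (dual f H)
dual-vanishesOnNonempty f {H} H≡0 (u , v , refl) =
  trans (dual-∷ʳ f H u v)
        (trans (revWordImage-∷ f v (reverse u) H) (∑-zero (ΔF f) term≡0))
  where
  term≡0 : ∀ x → ⟦ revWordImage (proj₁ x) (reverse u) *P letterImage (proj₂ x) v ⟧ H ≡ 0ℚ
  term≡0 (a , b) =
    trans (⟦⟧-*P (revWordImage a (reverse u)) (letterImage b v) H)
          (⟦⟧-vanishes (revWordImage a (reverse u))
             (λ s → trans (⟦⟧-cong-All (letterImage-nonempty b v) (λ ne → H≡0 (nonempty-++ s ne)))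
                          (⟦⟧-𝟘 (letterImage b v))))

-- Commutation relations between ψ and ∂

∂ᵀ : Functional → Functional
∂ᵀ = dual (● · 𝕀)

ψᵀ-at : ∀ G u s a → ψᵀ G (u ++ s ∷ʳ a) ≡ ψᵀ (u ▸ G) (s ∷ʳ a)
ψᵀ-at G u s a = sym (ψᵀ-▸ u G (s , a , refl))

ψᵀ◂X : ∀ G → ψᵀ G ◂ [ X ] ≗ G ◂ (X ∷ Y ∷ [])
ψᵀ◂X G w = ψᵀ-∷ʳ G w X

ψᵀ◂Y : ∀ G → ψᵀ G ◂ [ Y ] ≗ G ◂ (X ∷ Y ∷ []) ⊕ 2ℚ ⊛ G ◂ (Y ∷ Y ∷ [])
ψᵀ◂Y G w = ψᵀ-∷ʳ G w Y

∂ᵀ-∷ʳ : ∀ G u a → ∂ᵀ G (u ∷ʳ a) ≡ ∂ᵀ (G ◂ [ a ]) u + sign a * G (u ++ X ∷ Y ∷ [])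
∂ᵀ-∷ʳ G u a =
  trans (dual-B₊-∷ʳ 𝕀 G u a)
        (cong (λ z → ∂ᵀ (G ◂ [ a ]) u + sign a * z) (trans (dual-𝕀 (ψᵀ G) (u ∷ʳ X)) (ψᵀ-∷ʳ G u X)))

∂ᵀ-++₂ : ∀ G u a b → ∂ᵀ G (u ++ a ∷ b ∷ []) ≡
         ∂ᵀ (G ◂ (a ∷ b ∷ [])) u + sign a * G (u ++ X ∷ Y ∷ b ∷ []) + sign b * G (u ++ a ∷ X ∷ Y ∷ [])
∂ᵀ-++₂ G u a b =
  trans (dual-B₊-++₂ 𝕀 G u a b)
        (cong₂ (λ p q → ∂ᵀ (G ◂ (a ∷ b ∷ [])) u + sign a * p + sign b * q)
               (trans (dual-𝕀 _ (u ∷ʳ X)) (trans (ψᵀ-∷ʳ (G ◂ [ b ]) u X) (◂-◂ G [ b ] (X ∷ Y ∷ []) u)))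
               (trans (dual-𝕀 _ (u ∷ʳ a ∷ʳ X)) (trans (ψᵀ-∷ʳ G (u ∷ʳ a) X) (cong G (List.∷ʳ-++ u a _)))))

-- Transpose of ψ∂ − ∂ψ − ψ(· (x + y)) + ψ(·) y, which vanishes on words ending in a letter.
ψ∂-relation : Functional → Functional
ψ∂-relation G = ψᵀ (G ◂ [ Y ]) ⊖ ψᵀ G ◂ [ X ] ⊖ ψᵀ G ◂ [ Y ] ⊖ ψᵀ (∂ᵀ G) ⊕ ∂ᵀ (ψᵀ G)

-- Transpose of ψψ − ψ(·) y − ψ(· (x + y)), which vanishes on 𝔥 (x + y).
ψψ-relation : Functional → Functional
ψψ-relation G = ψᵀ (ψᵀ G) ⊖ ψᵀ (G ◂ [ Y ]) ⊖ ψᵀ G ◂ [ X ] ⊖ ψᵀ G ◂ [ Y ]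

module _ (G : Functional) (u : Word) where
  private
    g d : Word → ℚ
    g s = G (u ++ s)
    d s = ∂ᵀ (G ◂ s) u
    XXY XYY YXY YYY : Word
    XXY = X ∷ X ∷ Y ∷ []
    XYY = X ∷ Y ∷ Y ∷ []
    YXY = Y ∷ X ∷ Y ∷ []
    YYY = Y ∷ Y ∷ Y ∷ []

    ψᵀ-∷ʳ∷ʳ : ∀ a b → ψᵀ G (u ∷ʳ a ∷ʳ b) ≡ ψᵀ (u ▸ G) (a ∷ b ∷ [])
    ψᵀ-∷ʳ∷ʳ a b = trans (◂-◂ (ψᵀ G) [ b ] [ a ] u) (ψᵀ-at G u [ a ] b)

    ψᵀ◂Y-∷ʳX : ψᵀ (G ◂ [ Y ]) (u ∷ʳ X) ≡ g XYY
    ψᵀ◂Y-∷ʳX = trans (ψᵀ-∷ʳ (G ◂ [ Y ]) u X) (◂-◂ G [ Y ] (X ∷ Y ∷ []) u)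

    ψᵀ◂Y-∷ʳY : ψᵀ (G ◂ [ Y ]) (u ∷ʳ Y) ≡ g XYY + 2ℚ * g YYY
    ψᵀ◂Y-∷ʳY = trans (ψᵀ-∷ʳ (G ◂ [ Y ]) u Y)
                     (cong₂ (λ a b → a + 2ℚ * b) (◂-◂ G [ Y ] (X ∷ Y ∷ []) u) (◂-◂ G [ Y ] (Y ∷ Y ∷ []) u))

    ∂ᵀψᵀ-∷ʳ : ∀ a → ∂ᵀ (ψᵀ G) (u ∷ʳ a) ≡ ∂ᵀ (ψᵀ G ◂ [ a ]) u + sign a * (g XXY + 2ℚ * g XYY)
    ∂ᵀψᵀ-∷ʳ a = trans (∂ᵀ-∷ʳ (ψᵀ G) u a) (cong (λ z → ∂ᵀ (ψᵀ G ◂ [ a ]) u + sign a * z) (ψᵀ-at G u [ X ] Y))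

  ψ∂-relation-∷ʳX : ψ∂-relation G (u ∷ʳ X) ≡ 0ℚ
  ψ∂-relation-∷ʳX = begin
    ψ∂-relation G (u ∷ʳ X)
      ≡⟨ cong₂ _+_ (cong₂ _-_ (cong₂ _-_ (cong₂ _-_ ψᵀ◂Y-∷ʳX (ψᵀ-∷ʳ∷ʳ X X)) (ψᵀ-∷ʳ∷ʳ X Y)) ψᵀ∂ᵀ) ∂ᵀψᵀ ⟩
    g XYY - g XXY - (g XXY + 2ℚ * g XYY) - (d (X ∷ Y ∷ []) + 1ℚ * g XYY + - 1ℚ * g XXY)
      + (d (X ∷ Y ∷ []) + 1ℚ * (g XXY + 2ℚ * g XYY))
      ≡⟨ solve 3 (λ a b d → a :- b :- (b :+ con 2ℚ :* a) :- (d :+ con 1ℚ :* a :+ con (- 1ℚ) :* b)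
                            :+ (d :+ con 1ℚ :* (b :+ con 2ℚ :* a)) := con 0ℚ) refl (g XYY) (g XXY) (d (X ∷ Y ∷ [])) ⟩
    0ℚ ∎
    where
    ψᵀ∂ᵀ : ψᵀ (∂ᵀ G) (u ∷ʳ X) ≡ d (X ∷ Y ∷ []) + 1ℚ * g XYY + - 1ℚ * g XXY
    ψᵀ∂ᵀ = trans (ψᵀ-∷ʳ (∂ᵀ G) u X) (∂ᵀ-++₂ G u X Y)
    ∂ᵀψᵀ : ∂ᵀ (ψᵀ G) (u ∷ʳ X) ≡ d (X ∷ Y ∷ []) + 1ℚ * (g XXY + 2ℚ * g XYY)
    ∂ᵀψᵀ = trans (∂ᵀψᵀ-∷ʳ X) (cong (λ z → z + 1ℚ * (g XXY + 2ℚ * g XYY)) (dual-cong (● · 𝕀) (ψᵀ◂X G) u))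

  ψ∂-relation-∷ʳY : ψ∂-relation G (u ∷ʳ Y) ≡ 0ℚ
  ψ∂-relation-∷ʳY = begin
    ψ∂-relation G (u ∷ʳ Y)
      ≡⟨ cong₂ _+_ (cong₂ _-_ (cong₂ _-_ (cong₂ _-_ ψᵀ◂Y-∷ʳY (ψᵀ-∷ʳ∷ʳ Y X)) (ψᵀ-∷ʳ∷ʳ Y Y)) ψᵀ∂ᵀ) ∂ᵀψᵀ ⟩
    g XYY + 2ℚ * g YYY - g YXY - (g YXY + 2ℚ * g YYY)
      - ((d (X ∷ Y ∷ []) + 1ℚ * g XYY + - 1ℚ * g XXY) + 2ℚ * (d (Y ∷ Y ∷ []) + - 1ℚ * g XYY + - 1ℚ * g YXY))
      + ((d (X ∷ Y ∷ []) + 2ℚ * d (Y ∷ Y ∷ [])) + - 1ℚ * (g XXY + 2ℚ * g XYY))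
      ≡⟨ solve 6 (λ a b c e d₁ d₂ → a :+ con 2ℚ :* b :- c :- (c :+ con 2ℚ :* b)
                      :- ((d₁ :+ con 1ℚ :* a :+ con (- 1ℚ) :* e) :+ con 2ℚ :* (d₂ :+ con (- 1ℚ) :* a :+ con (- 1ℚ) :* c))
                      :+ ((d₁ :+ con 2ℚ :* d₂) :+ con (- 1ℚ) :* (e :+ con 2ℚ :* a)) := con 0ℚ)
                 refl (g XYY) (g YYY) (g YXY) (g XXY) (d (X ∷ Y ∷ [])) (d (Y ∷ Y ∷ [])) ⟩
    0ℚ ∎
    where
    ψᵀ∂ᵀ : ψᵀ (∂ᵀ G) (u ∷ʳ Y) ≡
           (d (X ∷ Y ∷ []) + 1ℚ * g XYY + - 1ℚ * g XXY) + 2ℚ * (d (Y ∷ Y ∷ []) + - 1ℚ * g XYY + - 1ℚ * g YXY)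
    ψᵀ∂ᵀ = trans (ψᵀ-∷ʳ (∂ᵀ G) u Y) (cong₂ (λ a b → a + 2ℚ * b) (∂ᵀ-++₂ G u X Y) (∂ᵀ-++₂ G u Y Y))
    ∂ᵀψᵀ : ∂ᵀ (ψᵀ G) (u ∷ʳ Y) ≡ (d (X ∷ Y ∷ []) + 2ℚ * d (Y ∷ Y ∷ [])) + - 1ℚ * (g XXY + 2ℚ * g XYY)
    ∂ᵀψᵀ = trans (∂ᵀψᵀ-∷ʳ Y)
                 (cong (λ z → z + - 1ℚ * (g XXY + 2ℚ * g XYY))
                       (trans (dual-cong (● · 𝕀) (ψᵀ◂Y G) u)
                              (trans (dual-⊕ (● · 𝕀) _ _ u) (cong (d (X ∷ Y ∷ []) +_) (dual-⊛ (● · 𝕀) 2ℚ _ u)))))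

  ψψ-relation-∷ʳX+∷ʳY : ψψ-relation G (u ∷ʳ X) + ψψ-relation G (u ∷ʳ Y) ≡ 0ℚ
  ψψ-relation-∷ʳX+∷ʳY = begin
    ψψ-relation G (u ∷ʳ X) + ψψ-relation G (u ∷ʳ Y)
      ≡⟨ cong₂ _+_ (cong₂ _-_ (cong₂ _-_ (cong₂ _-_ ψᵀψᵀ-X ψᵀ◂Y-∷ʳX) (ψᵀ-∷ʳ∷ʳ X X)) (ψᵀ-∷ʳ∷ʳ X Y))
                   (cong₂ _-_ (cong₂ _-_ (cong₂ _-_ ψᵀψᵀ-Y ψᵀ◂Y-∷ʳY) (ψᵀ-∷ʳ∷ʳ Y X)) (ψᵀ-∷ʳ∷ʳ Y Y)) ⟩
    ((g XXY + 2ℚ * g XYY) - g XYY - g XXY - (g XXY + 2ℚ * g XYY))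
      + ((g XXY + 2ℚ * g XYY) + 2ℚ * (g YXY + 2ℚ * g YYY) - (g XYY + 2ℚ * g YYY) - g YXY - (g YXY + 2ℚ * g YYY))
      ≡⟨ solve 4 (λ a b c e → ((a :+ con 2ℚ :* b) :- b :- a :- (a :+ con 2ℚ :* b))
                              :+ ((a :+ con 2ℚ :* b) :+ con 2ℚ :* (c :+ con 2ℚ :* e) :- (b :+ con 2ℚ :* e) :- c
                                  :- (c :+ con 2ℚ :* e)) := con 0ℚ)
                 refl (g XXY) (g XYY) (g YXY) (g YYY) ⟩
    0ℚ ∎
    where
    ψᵀψᵀ-X : ψᵀ (ψᵀ G) (u ∷ʳ X) ≡ g XXY + 2ℚ * g XYY
    ψᵀψᵀ-X = trans (ψᵀ-∷ʳ (ψᵀ G) u X) (ψᵀ-at G u [ X ] Y)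
    ψᵀψᵀ-Y : ψᵀ (ψᵀ G) (u ∷ʳ Y) ≡ (g XXY + 2ℚ * g XYY) + 2ℚ * (g YXY + 2ℚ * g YYY)
    ψᵀψᵀ-Y = trans (ψᵀ-∷ʳ (ψᵀ G) u Y) (cong₂ (λ a b → a + 2ℚ * b) (ψᵀ-at G u [ X ] Y) (ψᵀ-at G u [ Y ] Y))

-- Transpose of (B₊U)~ ψ − ψ Ũ ψ − ψ (B₊U)~ + ψ ψ Ũ − ∂ ψ Ũ + ψ ∂ Ũ, where ∂ = ●~.
sixTermᵀ : Forest → Functional → Functional
sixTermᵀ U G = ψᵀ (dual (B₊ U · 𝕀) G) ⊖ ψᵀ (dual U (ψᵀ G)) ⊖ dual (B₊ U · 𝕀) (ψᵀ G)
               ⊕ dual U (ψᵀ (ψᵀ G)) ⊖ dual U (ψᵀ (∂ᵀ G)) ⊕ dual U (∂ᵀ (ψᵀ G))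

dual-ψ∂-relation : ∀ U G w → dual U (ψ∂-relation G) w ≡
                   dual U (ψᵀ (G ◂ [ Y ])) w - dual U (ψᵀ G ◂ [ X ]) w - dual U (ψᵀ G ◂ [ Y ]) w
                   - dual U (ψᵀ (∂ᵀ G)) w + dual U (∂ᵀ (ψᵀ G)) w
dual-ψ∂-relation U G w =
  trans (dual-⊕ U _ H₅ w) (cong (_+ dual U H₅ w) (trans (dual-⊖ U _ H₄ w) (cong (_- dual U H₄ w)
        (trans (dual-⊖ U _ H₃ w) (cong (_- dual U H₃ w) (dual-⊖ U H₁ H₂ w))))))
  where
  H₁ H₂ H₃ H₄ H₅ : Functional
  H₁ = ψᵀ (G ◂ [ Y ])
  H₂ = ψᵀ G ◂ [ X ]
  H₃ = ψᵀ G ◂ [ Y ]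
  H₄ = ψᵀ (∂ᵀ G)
  H₅ = ∂ᵀ (ψᵀ G)

dual-ψψ-relation : ∀ U G w → dual U (ψψ-relation G) w ≡
                   dual U (ψᵀ (ψᵀ G)) w - dual U (ψᵀ (G ◂ [ Y ])) w - dual U (ψᵀ G ◂ [ X ]) w
                   - dual U (ψᵀ G ◂ [ Y ]) w
dual-ψψ-relation U G w =
  trans (dual-⊖ U _ H₄ w) (cong (_- dual U H₄ w) (trans (dual-⊖ U _ H₃ w) (cong (_- dual U H₃ w) (dual-⊖ U H₁ H₂ w))))
  where
  H₁ H₂ H₃ H₄ : Functional
  H₁ = ψᵀ (ψᵀ G)
  H₂ = ψᵀ (G ◂ [ Y ])
  H₃ = ψᵀ G ◂ [ X ]
  H₄ = ψᵀ G ◂ [ Y ]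

module _ {U} (U-tree : TreeOrEmpty U) (G : Functional) (u : Word) where
  private
    φ φ′ : Functional → Functional
    φ = dual U
    φ′ = dual (B₊ U · 𝕀)



  sixTermᵀ-∷ʳX : sixTermᵀ U G (u ∷ʳ X) ≡ dual U (ψ∂-relation G) (u ∷ʳ X)
  sixTermᵀ-∷ʳX = begin
    sixTermᵀ U G (u ∷ʳ X)
      ≡⟨ cong₂ _+_ (cong₂ _-_ (cong₂ _+_ (cong₂ _-_ (cong₂ _-_ T₁ T₂) T₃) refl) refl) refl ⟩
    (a + 1ℚ * r₁ + - 1ℚ * b₁) - b₂ - (a + 1ℚ * r₂) + r₂ - r₃ + r₄
      ≡⟨ solve 7 (λ a r₁ b₁ b₂ r₂ r₃ r₄ → (a :+ con 1ℚ :* r₁ :+ con (- 1ℚ) :* b₁) :- b₂ :- (a :+ con 1ℚ :* r₂)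
                                         :+ r₂ :- r₃ :+ r₄ := r₁ :- (b₁ :+ b₂) :- r₃ :+ r₄)
                 refl a r₁ b₁ b₂ r₂ r₃ r₄ ⟩
    r₁ - (b₁ + b₂) - r₃ + r₄
      ≡⟨ cong (λ z → r₁ - z - r₃ + r₄) (dual-∷ʳX+∷ʳY U-tree (ψᵀ G) (u ∷ʳ X)) ⟩
    r₁ - (r₅ + r₆) - r₃ + r₄
      ≡⟨ solve 5 (λ r₁ r₅ r₆ r₃ r₄ → r₁ :- (r₅ :+ r₆) :- r₃ :+ r₄ := r₁ :- r₅ :- r₆ :- r₃ :+ r₄) refl r₁ r₅ r₆ r₃ r₄ ⟩
    r₁ - r₅ - r₆ - r₃ + r₄
      ≡⟨ dual-ψ∂-relation U G (u ∷ʳ X) ⟨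
    dual U (ψ∂-relation G) (u ∷ʳ X) ∎
    where
    a r₁ r₂ r₃ r₄ r₅ r₆ b₁ b₂ : ℚ
    a = φ′ (G ◂ (X ∷ Y ∷ [])) u
    r₁ = φ (ψᵀ (G ◂ [ Y ])) (u ∷ʳ X)
    r₂ = φ (ψᵀ (ψᵀ G)) (u ∷ʳ X)
    r₃ = φ (ψᵀ (∂ᵀ G)) (u ∷ʳ X)
    r₄ = φ (∂ᵀ (ψᵀ G)) (u ∷ʳ X)
    r₅ = φ (ψᵀ G ◂ [ X ]) (u ∷ʳ X)
    r₆ = φ (ψᵀ G ◂ [ Y ]) (u ∷ʳ X)
    b₁ = φ (ψᵀ G) (u ∷ʳ X ∷ʳ X)
    b₂ = φ (ψᵀ G) (u ∷ʳ X ∷ʳ Y)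
    T₁ : ψᵀ (φ′ G) (u ∷ʳ X) ≡ a + 1ℚ * r₁ + - 1ℚ * b₁
    T₁ = trans (ψᵀ-∷ʳ (φ′ G) u X) (dual-B₊-++₂ U G u X Y)
    T₂ : ψᵀ (φ (ψᵀ G)) (u ∷ʳ X) ≡ b₂
    T₂ = trans (ψᵀ-∷ʳ (φ (ψᵀ G)) u X) (cong (φ (ψᵀ G)) (sym (List.++-assoc u [ X ] [ Y ])))
    T₃ : φ′ (ψᵀ G) (u ∷ʳ X) ≡ a + 1ℚ * r₂
    T₃ = trans (dual-B₊-∷ʳ U (ψᵀ G) u X) (cong (_+ 1ℚ * r₂) (dual-cong (B₊ U · 𝕀) (ψᵀ◂X G) u))

  sixTermᵀ-∷ʳY : sixTermᵀ U G (u ∷ʳ Y) ≡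
                 dual U (ψ∂-relation G) (u ∷ʳ Y) + (dual U (ψψ-relation G) (u ∷ʳ X) + dual U (ψψ-relation G) (u ∷ʳ Y))
  sixTermᵀ-∷ʳY = begin
    sixTermᵀ U G (u ∷ʳ Y)
      ≡⟨ cong₂ _+_ (cong₂ _-_ (cong₂ _+_ (cong₂ _-_ (cong₂ _-_ T₁ T₂) T₃) refl) refl) refl ⟩
    ((a₁ + 1ℚ * r₁ + - 1ℚ * b₁) + 2ℚ * (a₂ + - 1ℚ * r₁ + - 1ℚ * b₃)) - (b₂ + 2ℚ * b₄)
      - ((a₁ + 2ℚ * a₂) + - 1ℚ * r₂) + s₂ - s₃ + s₄
      ≡⟨ solve 11 (λ a₁ a₂ r₁ r₂ b₁ b₂ b₃ b₄ s₂ s₃ s₄ →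
                     ((a₁ :+ con 1ℚ :* r₁ :+ con (- 1ℚ) :* b₁) :+ con 2ℚ :* (a₂ :+ con (- 1ℚ) :* r₁ :+ con (- 1ℚ) :* b₃))
                     :- (b₂ :+ con 2ℚ :* b₄) :- ((a₁ :+ con 2ℚ :* a₂) :+ con (- 1ℚ) :* r₂) :+ s₂ :- s₃ :+ s₄
                     := r₂ :- r₁ :+ s₂ :- s₃ :+ s₄ :- (b₁ :+ b₂) :- con 2ℚ :* (b₃ :+ b₄))
                 refl a₁ a₂ r₁ r₂ b₁ b₂ b₃ b₄ s₂ s₃ s₄ ⟩
    r₂ - r₁ + s₂ - s₃ + s₄ - (b₁ + b₂) - 2ℚ * (b₃ + b₄)
      ≡⟨ cong₂ (λ p q → r₂ - r₁ + s₂ - s₃ + s₄ - p - 2ℚ * q)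
               (dual-∷ʳX+∷ʳY U-tree (ψᵀ G) (u ∷ʳ X)) (dual-∷ʳX+∷ʳY U-tree (ψᵀ G) (u ∷ʳ Y)) ⟩
    r₂ - r₁ + s₂ - s₃ + s₄ - (r₅ + r₆) - 2ℚ * (s₅ + s₆)
      ≡⟨ solve 10 (λ r₁ r₂ r₅ r₆ s₁ s₂ s₃ s₄ s₅ s₆ →
                     r₂ :- r₁ :+ s₂ :- s₃ :+ s₄ :- (r₅ :+ r₆) :- con 2ℚ :* (s₅ :+ s₆)
                     := (s₁ :- s₅ :- s₆ :- s₃ :+ s₄) :+ ((r₂ :- r₁ :- r₅ :- r₆) :+ (s₂ :- s₁ :- s₅ :- s₆)))
                 refl r₁ r₂ r₅ r₆ s₁ s₂ s₃ s₄ s₅ s₆ ⟩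
    (s₁ - s₅ - s₆ - s₃ + s₄) + ((r₂ - r₁ - r₅ - r₆) + (s₂ - s₁ - s₅ - s₆))
      ≡⟨ cong₂ _+_ (dual-ψ∂-relation U G (u ∷ʳ Y))
                   (cong₂ _+_ (dual-ψψ-relation U G (u ∷ʳ X)) (dual-ψψ-relation U G (u ∷ʳ Y))) ⟨
    dual U (ψ∂-relation G) (u ∷ʳ Y) + (dual U (ψψ-relation G) (u ∷ʳ X) + dual U (ψψ-relation G) (u ∷ʳ Y)) ∎
    where
    a₁ a₂ r₁ r₂ r₅ r₆ s₁ s₂ s₃ s₄ s₅ s₆ b₁ b₂ b₃ b₄ : ℚ
    a₁ = φ′ (G ◂ (X ∷ Y ∷ [])) u
    a₂ = φ′ (G ◂ (Y ∷ Y ∷ [])) u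
    r₁ = φ (ψᵀ (G ◂ [ Y ])) (u ∷ʳ X)
    r₂ = φ (ψᵀ (ψᵀ G)) (u ∷ʳ X)
    r₅ = φ (ψᵀ G ◂ [ X ]) (u ∷ʳ X)
    r₆ = φ (ψᵀ G ◂ [ Y ]) (u ∷ʳ X)
    s₁ = φ (ψᵀ (G ◂ [ Y ])) (u ∷ʳ Y)
    s₂ = φ (ψᵀ (ψᵀ G)) (u ∷ʳ Y)
    s₃ = φ (ψᵀ (∂ᵀ G)) (u ∷ʳ Y)
    s₄ = φ (∂ᵀ (ψᵀ G)) (u ∷ʳ Y)
    s₅ = φ (ψᵀ G ◂ [ X ]) (u ∷ʳ Y)
    s₆ = φ (ψᵀ G ◂ [ Y ]) (u ∷ʳ Y)
    b₁ = φ (ψᵀ G) (u ∷ʳ X ∷ʳ X)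
    b₂ = φ (ψᵀ G) (u ∷ʳ X ∷ʳ Y)
    b₃ = φ (ψᵀ G) (u ∷ʳ Y ∷ʳ X)
    b₄ = φ (ψᵀ G) (u ∷ʳ Y ∷ʳ Y)
    T₁ : ψᵀ (φ′ G) (u ∷ʳ Y) ≡ (a₁ + 1ℚ * r₁ + - 1ℚ * b₁) + 2ℚ * (a₂ + - 1ℚ * r₁ + - 1ℚ * b₃)
    T₁ = trans (ψᵀ-∷ʳ (φ′ G) u Y) (cong₂ (λ p q → p + 2ℚ * q) (dual-B₊-++₂ U G u X Y) (dual-B₊-++₂ U G u Y Y))
    T₂ : ψᵀ (φ (ψᵀ G)) (u ∷ʳ Y) ≡ b₂ + 2ℚ * b₄
    T₂ = trans (ψᵀ-∷ʳ (φ (ψᵀ G)) u Y)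
               (cong₂ (λ p q → φ (ψᵀ G) p + 2ℚ * φ (ψᵀ G) q)
                      (sym (List.++-assoc u [ X ] [ Y ])) (sym (List.++-assoc u [ Y ] [ Y ])))
    T₃ : φ′ (ψᵀ G) (u ∷ʳ Y) ≡ (a₁ + 2ℚ * a₂) + - 1ℚ * r₂
    T₃ = trans (dual-B₊-∷ʳ U (ψᵀ G) u Y)
               (cong (_+ - 1ℚ * r₂) (trans (dual-cong (B₊ U · 𝕀) (ψᵀ◂Y G) u)
                                           (trans (dual-⊕ (B₊ U · 𝕀) _ _ u) (cong (a₁ +_) (dual-⊛ (B₊ U · 𝕀) 2ℚ _ u)))))

sixTermᵀ-[] : ∀ {U} → TreeOrEmpty U → ∀ G → sixTermᵀ U G [] ≡ 0ℚ
sixTermᵀ-[] empty G = refl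
sixTermᵀ-[] (tree t) G = refl

ψ∂-relation-vanishesOnNonempty : ∀ G → VanishesOnNonempty (ψ∂-relation G)
ψ∂-relation-vanishesOnNonempty G (u , X , refl) = ψ∂-relation-∷ʳX G u
ψ∂-relation-vanishesOnNonempty G (u , Y , refl) = ψ∂-relation-∷ʳY G u

sixTermᵀ-vanishes : ∀ {U} → TreeOrEmpty U → ∀ G → sixTermᵀ U G ≗ 𝟘
sixTermᵀ-vanishes {U} U-tree G w with initLast w
... | [] = sixTermᵀ-[] U-tree G
... | u ∷ʳ′ X =
  trans (sixTermᵀ-∷ʳX U-tree G u) (dual-vanishesOnNonempty U (ψ∂-relation-vanishesOnNonempty G) (u , X , refl))
... | u ∷ʳ′ Y = begin
  sixTermᵀ U G (u ∷ʳ Y)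
    ≡⟨ sixTermᵀ-∷ʳY U-tree G u ⟩
  dual U (ψ∂-relation G) (u ∷ʳ Y) + (dual U (ψψ-relation G) (u ∷ʳ X) + dual U (ψψ-relation G) (u ∷ʳ Y))
    ≡⟨ cong₂ _+_ (dual-vanishesOnNonempty U (ψ∂-relation-vanishesOnNonempty G) (u , Y , refl))
                 (dual-∷ʳX+∷ʳY U-tree (ψψ-relation G) u) ⟩
  0ℚ + (dual U (ψψ-relation G ◂ [ X ]) u + dual U (ψψ-relation G ◂ [ Y ]) u)
    ≡⟨ cong (0ℚ +_) (dual-⊕ U _ _ u) ⟨
  0ℚ + dual U (ψψ-relation G ◂ [ X ] ⊕ ψψ-relation G ◂ [ Y ]) u
    ≡⟨ cong (0ℚ +_) (⟦⟧-vanishes (revWordImage U (reverse u)) (ψψ-relation-∷ʳX+∷ʳY G)) ⟩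
  0ℚ + 0ℚ
    ≡⟨ ℚ.+-identityʳ 0ℚ ⟩
  0ℚ ∎

-- The six-term element

shape₁ shape₂ shape₃ shape₄ shape₅ shape₆ : Forest → Forest → Forest
shape₁ U V = B₊ U · B₊ V · 𝕀
shape₂ U V = B₊ (U ⊗F (B₊ V · 𝕀)) · 𝕀
shape₃ U V = B₊ (B₊ U · V) · 𝕀
shape₄ U V = B₊ (B₊ (U ⊗F V) · 𝕀) · 𝕀
shape₅ U V = ● · B₊ (U ⊗F V) · 𝕀
shape₆ U V = B₊ (● · (U ⊗F V)) · 𝕀

sixShapes : List (ℚ × (Forest → Forest → Forest))
sixShapes = (1ℚ , shape₁) ∷ (- 1ℚ , shape₂) ∷ (- 1ℚ , shape₃) ∷ (1ℚ , shape₄) ∷ (- 1ℚ , shape₅) ∷ (1ℚ , shape₆) ∷ []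

sixTerm : Forest → Forest → ℋ
sixTerm U V = map (λ x → (proj₁ x , proj₂ x U V)) sixShapes

NonemptyForest : Forest → Set
NonemptyForest f = ∃₂ λ t g → f ≡ t · g

sixTerm-nonempty : ∀ U V → All (NonemptyForest ∘ proj₂) (sixTerm U V)
sixTerm-nonempty U V = p ∷ p ∷ p ∷ p ∷ p ∷ p ∷ []
  where
  p : ∀ {t g} → NonemptyForest (t · g)
  p = _ , _ , refl

sixTerm-letterX : ∀ {U} → TreeOrEmpty U → ∀ V G → ⟦ sixTerm U V ⟧ (λ f → ⟦ letterImage f X ⟧ G) ≡ 0ℚ
sixTerm-letterX {U} U-tree V G = begin
  ⟦ sixTerm U V ⟧ (λ f → ⟦ letterImage f X ⟧ G)
    ≡⟨ cong₂ (λ a b → 1ℚ * a + b) e₁ (cong₂ (λ a b → - 1ℚ * a + b) e₂ (cong₂ (λ a b → - 1ℚ * a + b) e₃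
         (cong₂ (λ a b → 1ℚ * a + b) e₄ (cong₂ (λ a b → - 1ℚ * a + b) e₅ (cong (λ a → 1ℚ * a + 0ℚ) e₆))))) ⟩
  1ℚ * t₁ + (- 1ℚ * t₂ + (- 1ℚ * t₃ + (1ℚ * t₄ + (- 1ℚ * t₅ + (1ℚ * t₆ + 0ℚ)))))
    ≡⟨ solve 6 (λ t₁ t₂ t₃ t₄ t₅ t₆ →
                  con 1ℚ :* t₁ :+ (con (- 1ℚ) :* t₂ :+ (con (- 1ℚ) :* t₃ :+ (con 1ℚ :* t₄ :+ (con (- 1ℚ) :* t₅
                  :+ (con 1ℚ :* t₆ :+ con 0ℚ))))) := t₁ :- t₂ :- t₃ :+ t₄ :- t₅ :+ t₆) refl t₁ t₂ t₃ t₄ t₅ t₆ ⟩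
  t₁ - t₂ - t₃ + t₄ - t₅ + t₆
    ≡⟨ linear ⟨
  ⟦ F ⟧ (sixTermᵀ U G)
    ≡⟨ ⟦⟧-vanishes F (sixTermᵀ-vanishes U-tree G) ⟩
  0ℚ ∎
  where
  F : Poly
  F = letterImage V X
  H₁ H₂ H₃ H₄ H₅ H₆ : Functional
  H₁ = ψᵀ (dual (B₊ U · 𝕀) G)
  H₂ = ψᵀ (dual U (ψᵀ G))
  H₃ = dual (B₊ U · 𝕀) (ψᵀ G)
  H₄ = dual U (ψᵀ (ψᵀ G))
  H₅ = dual U (ψᵀ (∂ᵀ G))
  H₆ = dual U (∂ᵀ (ψᵀ G))
  t₁ t₂ t₃ t₄ t₅ t₆ : ℚ
  t₁ = ⟦ F ⟧ H₁
  t₂ = ⟦ F ⟧ H₂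
  t₃ = ⟦ F ⟧ H₃
  t₄ = ⟦ F ⟧ H₄
  t₅ = ⟦ F ⟧ H₅
  t₆ = ⟦ F ⟧ H₆
  linear : ⟦ F ⟧ (sixTermᵀ U G) ≡ t₁ - t₂ - t₃ + t₄ - t₅ + t₆
  linear = trans (⟦⟧-⊕ F _ H₆) (cong (_+ t₆) (trans (⟦⟧-⊖ F _ H₅) (cong (_- t₅) (trans (⟦⟧-⊕ F _ H₄)
             (cong (_+ t₄) (trans (⟦⟧-⊖ F _ H₃) (cong (_- t₃) (⟦⟧-⊖ F H₁ H₂))))))))
  e₁ : ⟦ letterImage (shape₁ U V) X ⟧ G ≡ t₁
  e₁ = trans (cong (λ p → ⟦ p ⟧ G) (letterImage-composite (B₊ U) (B₊ V) 𝕀 X))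
             (trans (⟦⟧-image (B₊ U · 𝕀) (letterImage (B₊ V · 𝕀) X) G) (letterImage-B₊ V _))
  e₂ : ⟦ letterImage (shape₂ U V) X ⟧ G ≡ t₂
  e₂ = trans (letterImage-B₊ (U ⊗F (B₊ V · 𝕀)) G)
             (trans (letterImage-⊗F U-tree (B₊ V · 𝕀) (ψᵀ G)) (letterImage-B₊ V _))
  e₃ : ⟦ letterImage (shape₃ U V) X ⟧ G ≡ t₃
  e₃ = trans (letterImage-B₊ (B₊ U · V) G) (letterImage-⊗F (tree (B₊ U)) V (ψᵀ G))
  e₄ : ⟦ letterImage (shape₄ U V) X ⟧ G ≡ t₄
  e₄ = trans (letterImage-B₊ (B₊ (U ⊗F V) · 𝕀) G)
             (trans (letterImage-B₊ (U ⊗F V) (ψᵀ G)) (letterImage-⊗F U-tree V (ψᵀ (ψᵀ G))))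
  e₅ : ⟦ letterImage (shape₅ U V) X ⟧ G ≡ t₅
  e₅ = trans (cong (λ p → ⟦ p ⟧ G) (letterImage-composite ● (B₊ (U ⊗F V)) 𝕀 X))
             (trans (⟦⟧-image (● · 𝕀) (letterImage (B₊ (U ⊗F V) · 𝕀) X) G)
                    (trans (letterImage-B₊ (U ⊗F V) (∂ᵀ G)) (letterImage-⊗F U-tree V (ψᵀ (∂ᵀ G)))))
  e₆ : ⟦ letterImage (shape₆ U V) X ⟧ G ≡ t₆
  e₆ = trans (letterImage-B₊ (● · (U ⊗F V)) G)
             (trans (letterImage-⊗F (tree ●) (U ⊗F V) (ψᵀ G)) (letterImage-⊗F U-tree V (∂ᵀ (ψᵀ G))))

sixTerm-letter : ∀ {U} → TreeOrEmpty U → ∀ V v G → ⟦ sixTerm U V ⟧ (λ f → ⟦ letterImage f v ⟧ G) ≡ 0ℚ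
sixTerm-letter {U} U-tree V v G = begin
  ⟦ sixTerm U V ⟧ (λ f → ⟦ letterImage f v ⟧ G)
    ≡⟨ ⟦⟧-cong-All {G = λ f → ⟦ letterImage f v ⟧ G} {H = λ f → sign v * ⟦ letterImage f X ⟧ G}
         (sixTerm-nonempty U V) (λ { (t , g , refl) → letterImage-sign t g v G }) ⟩
  ⟦ sixTerm U V ⟧ (λ f → sign v * ⟦ letterImage f X ⟧ G)
    ≡⟨ ⟦⟧-⊛ (sixTerm U V) (sign v) (λ f → ⟦ letterImage f X ⟧ G) ⟩
  sign v * ⟦ sixTerm U V ⟧ (λ f → ⟦ letterImage f X ⟧ G)
    ≡⟨ cong (sign v *_) (sixTerm-letterX U-tree V G) ⟩
  sign v * 0ℚ
    ≡⟨ ℚ.*-zeroʳ (sign v) ⟩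
  0ℚ ∎

module _ (U V : Forest) (h : Forest × Forest → ℚ) where
  private
    h-grafted : Forest × Forest → ℚ
    h-grafted z = h (proj₁ z , B₊ (proj₂ z) · 𝕀)

    graftedV graftedU trunk bulletGrafted : ℚ
    graftedV = ∑ (ΔF V) (λ y → h (B₊ U · proj₁ y , B₊ (proj₂ y) · 𝕀))
    graftedU = ∑ (ΔF U) (λ x → h (proj₁ x ⊗F (B₊ V · 𝕀) , B₊ (proj₂ x) · 𝕀))
    trunk = h (B₊ (U ⊗F V) · 𝕀 , ● · 𝕀)
    bulletGrafted = ∑ (ΔF (U ⊗F V)) (λ w → h (● · proj₁ w , B₊ (proj₂ w) · 𝕀))

    cross-term : (Forest → Forest → Forest) → Forest × Forest → ℚ
    cross-term S x = ∑ (ΔF V) (λ y → h (proj₁ x ⊗F proj₁ y , S (proj₂ x) (proj₂ y)))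

    cross : (Forest → Forest → Forest) → ℚ
    cross S = ∑ (ΔF U) (cross-term S)

    Δ-shape₁ : ∑ (ΔF (shape₁ U V)) h ≡ h (shape₁ U V , 𝕀) + (graftedV + (graftedU + cross shape₁))
    Δ-shape₁ = begin
      ∑ (ΔF ((B₊ U · 𝕀) ⊗F (B₊ V · 𝕀))) h
        ≡⟨ ∑-ΔF-⊗F (B₊ U · 𝕀) (B₊ V · 𝕀) h ⟩
      ∑ (ΔF (B₊ U · 𝕀)) (λ x → ∑ (ΔF (B₊ V · 𝕀)) (λ y → h (x ⊗² y)))
        ≡⟨ ∑-ΔF-B₊ U (λ x → ∑ (ΔF (B₊ V · 𝕀)) (λ y → h (x ⊗² y))) ⟩
      ∑ (ΔF (B₊ V · 𝕀)) (λ y → h (B₊ U · proj₁ y , proj₂ y)) + ∑ (ΔF U) left-grafted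
        ≡⟨ cong₂ _+_ (∑-ΔF-B₊ V (λ y → h (B₊ U · proj₁ y , proj₂ y))) (∑-cong (ΔF U) split) ⟩
      (h (shape₁ U V , 𝕀) + graftedV)
        + ∑ (ΔF U) (λ x → h (proj₁ x ⊗F (B₊ V · 𝕀) , B₊ (proj₂ x) · 𝕀) + cross-term shape₁ x)
        ≡⟨ cong ((h (shape₁ U V , 𝕀) + graftedV) +_) (∑-+ (ΔF U) _ (cross-term shape₁)) ⟩
      (h (shape₁ U V , 𝕀) + graftedV) + (graftedU + cross shape₁)
        ≡⟨ ℚ.+-assoc (h (shape₁ U V , 𝕀)) graftedV _ ⟩
      h (shape₁ U V , 𝕀) + (graftedV + (graftedU + cross shape₁)) ∎
      where
      left-grafted : Forest × Forest → ℚ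
      left-grafted x = ∑ (ΔF (B₊ V · 𝕀)) (λ y → h (proj₁ x ⊗F proj₁ y , B₊ (proj₂ x) · proj₂ y))
      split : ∀ x → left-grafted x ≡ h (proj₁ x ⊗F (B₊ V · 𝕀) , B₊ (proj₂ x) · 𝕀) + cross-term shape₁ x
      split x = ∑-ΔF-B₊ V (λ y → h (proj₁ x ⊗F proj₁ y , B₊ (proj₂ x) · proj₂ y))

    Δ-shape₂ : ∑ (ΔF (shape₂ U V)) h ≡ h (shape₂ U V , 𝕀) + (graftedU + cross shape₂)
    Δ-shape₂ = begin
      ∑ (ΔF (shape₂ U V)) h
        ≡⟨ ∑-ΔF-B₊ (U ⊗F (B₊ V · 𝕀)) h ⟩
      h (shape₂ U V , 𝕀) + ∑ (ΔF (U ⊗F (B₊ V · 𝕀))) h-grafted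
        ≡⟨ cong (h (shape₂ U V , 𝕀) +_) (∑-ΔF-⊗F U (B₊ V · 𝕀) h-grafted) ⟩
      h (shape₂ U V , 𝕀) + ∑ (ΔF U) (λ x → ∑ (ΔF (B₊ V · 𝕀)) (λ y → h-grafted (x ⊗² y)))
        ≡⟨ cong (h (shape₂ U V , 𝕀) +_) (∑-cong (ΔF U) split) ⟩
      h (shape₂ U V , 𝕀) + ∑ (ΔF U) (λ x → h (proj₁ x ⊗F (B₊ V · 𝕀) , B₊ (proj₂ x) · 𝕀) + cross-term shape₂ x)
        ≡⟨ cong (h (shape₂ U V , 𝕀) +_) (∑-+ (ΔF U) _ (cross-term shape₂)) ⟩
      h (shape₂ U V , 𝕀) + (graftedU + cross shape₂) ∎
      where
      split : ∀ x → ∑ (ΔF (B₊ V · 𝕀)) (λ y → h-grafted (x ⊗² y)) ≡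
                    h (proj₁ x ⊗F (B₊ V · 𝕀) , B₊ (proj₂ x) · 𝕀) + cross-term shape₂ x
      split x = trans (∑-ΔF-B₊ V (λ y → h-grafted (x ⊗² y)))
                      (cong (λ z → h (proj₁ x ⊗F (B₊ V · 𝕀) , B₊ z · 𝕀) + cross-term shape₂ x)
                            (⊗F-identityʳ (proj₂ x)))

    Δ-shape₃ : ∑ (ΔF (shape₃ U V)) h ≡ h (shape₃ U V , 𝕀) + (graftedV + cross shape₃)
    Δ-shape₃ = begin
      ∑ (ΔF (shape₃ U V)) h
        ≡⟨ ∑-ΔF-B₊ (B₊ U · V) h ⟩
      h (shape₃ U V , 𝕀) + ∑ (ΔF ((B₊ U · 𝕀) ⊗F V)) h-grafted
        ≡⟨ cong (h (shape₃ U V , 𝕀) +_) (∑-ΔF-⊗F (B₊ U · 𝕀) V h-grafted) ⟩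
      h (shape₃ U V , 𝕀) + ∑ (ΔF (B₊ U · 𝕀)) (λ x → ∑ (ΔF V) (λ y → h-grafted (x ⊗² y)))
        ≡⟨ cong (h (shape₃ U V , 𝕀) +_) (∑-ΔF-B₊ U (λ x → ∑ (ΔF V) (λ y → h-grafted (x ⊗² y)))) ⟩
      h (shape₃ U V , 𝕀) + (graftedV + cross shape₃) ∎

    Δ-shape₄ : ∑ (ΔF (shape₄ U V)) h ≡ h (shape₄ U V , 𝕀) + (trunk + cross shape₄)
    Δ-shape₄ = begin
      ∑ (ΔF (shape₄ U V)) h
        ≡⟨ ∑-ΔF-B₊ (B₊ (U ⊗F V) · 𝕀) h ⟩
      h (shape₄ U V , 𝕀) + ∑ (ΔF (B₊ (U ⊗F V) · 𝕀)) h-grafted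
        ≡⟨ cong (h (shape₄ U V , 𝕀) +_) (∑-ΔF-B₊ (U ⊗F V) h-grafted) ⟩
      h (shape₄ U V , 𝕀) + (trunk + ∑ (ΔF (U ⊗F V)) (λ w → h (proj₁ w , B₊ (B₊ (proj₂ w) · 𝕀) · 𝕀)))
        ≡⟨ cong (λ z → h (shape₄ U V , 𝕀) + (trunk + z))
                (∑-ΔF-⊗F U V (λ w → h (proj₁ w , B₊ (B₊ (proj₂ w) · 𝕀) · 𝕀))) ⟩
      h (shape₄ U V , 𝕀) + (trunk + cross shape₄) ∎

    Δ-shape₅ : ∑ (ΔF (shape₅ U V)) h ≡ h (shape₅ U V , 𝕀) + (bulletGrafted + (trunk + cross shape₅))
    Δ-shape₅ = begin
      ∑ (ΔF ((● · 𝕀) ⊗F (B₊ (U ⊗F V) · 𝕀))) h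
        ≡⟨ ∑-ΔF-⊗F (● · 𝕀) (B₊ (U ⊗F V) · 𝕀) h ⟩
      ∑ (ΔF (● · 𝕀)) (λ x → ∑ (ΔF (B₊ (U ⊗F V) · 𝕀)) (λ z → h (x ⊗² z)))
        ≡⟨ ∑-ΔF-B₊ 𝕀 (λ x → ∑ (ΔF (B₊ (U ⊗F V) · 𝕀)) (λ z → h (x ⊗² z))) ⟩
      ∑ (ΔF (B₊ (U ⊗F V) · 𝕀)) (λ z → h (● · proj₁ z , proj₂ z))
        + (∑ (ΔF (B₊ (U ⊗F V) · 𝕀)) (λ z → h (proj₁ z , ● · proj₂ z)) + 0ℚ)
        ≡⟨ cong₂ _+_ (∑-ΔF-B₊ (U ⊗F V) (λ z → h (● · proj₁ z , proj₂ z)))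
                     (trans (ℚ.+-identityʳ _) (trans (∑-ΔF-B₊ (U ⊗F V) (λ z → h (proj₁ z , ● · proj₂ z)))
                            (cong (trunk +_) (∑-ΔF-⊗F U V (λ w → h (proj₁ w , ● · B₊ (proj₂ w) · 𝕀)))))) ⟩
      (h (shape₅ U V , 𝕀) + bulletGrafted) + (trunk + cross shape₅)
        ≡⟨ ℚ.+-assoc (h (shape₅ U V , 𝕀)) bulletGrafted _ ⟩
      h (shape₅ U V , 𝕀) + (bulletGrafted + (trunk + cross shape₅)) ∎

    Δ-shape₆ : ∑ (ΔF (shape₆ U V)) h ≡ h (shape₆ U V , 𝕀) + (bulletGrafted + cross shape₆)
    Δ-shape₆ = begin
      ∑ (ΔF (shape₆ U V)) h
        ≡⟨ ∑-ΔF-B₊ (● · (U ⊗F V)) h ⟩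
      h (shape₆ U V , 𝕀) + ∑ (ΔF ((● · 𝕀) ⊗F (U ⊗F V))) h-grafted
        ≡⟨ cong (h (shape₆ U V , 𝕀) +_) (∑-ΔF-⊗F (● · 𝕀) (U ⊗F V) h-grafted) ⟩
      h (shape₆ U V , 𝕀) + ∑ (ΔF (● · 𝕀)) (λ x → ∑ (ΔF (U ⊗F V)) (λ w → h-grafted (x ⊗² w)))
        ≡⟨ cong (h (shape₆ U V , 𝕀) +_) (∑-ΔF-B₊ 𝕀 (λ x → ∑ (ΔF (U ⊗F V)) (λ w → h-grafted (x ⊗² w)))) ⟩
      h (shape₆ U V , 𝕀) + (bulletGrafted + (∑ (ΔF (U ⊗F V)) (λ w → h (proj₁ w , B₊ (● · proj₂ w) · 𝕀)) + 0ℚ))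
        ≡⟨ cong (λ z → h (shape₆ U V , 𝕀) + (bulletGrafted + z))
                (trans (ℚ.+-identityʳ _) (∑-ΔF-⊗F U V (λ w → h (proj₁ w , B₊ (● · proj₂ w) · 𝕀)))) ⟩
      h (shape₆ U V , 𝕀) + (bulletGrafted + cross shape₆) ∎

  Δ-sixTerm : ⟦ sixTerm U V ⟧ (λ E → ∑ (ΔF E) h) ≡
              ⟦ sixTerm U V ⟧ (λ E → h (E , 𝕀))
              + ∑ (ΔF U) (λ x → ∑ (ΔF V) (λ y → ⟦ sixTerm (proj₂ x) (proj₂ y) ⟧ (λ E → h (proj₁ x ⊗F proj₁ y , E))))
  Δ-sixTerm = begin
    ⟦ sixTerm U V ⟧ (λ E → ∑ (ΔF E) h)
      ≡⟨ cong₂ (λ a b → 1ℚ * a + b) Δ-shape₁ (cong₂ (λ a b → - 1ℚ * a + b) Δ-shape₂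
           (cong₂ (λ a b → - 1ℚ * a + b) Δ-shape₃ (cong₂ (λ a b → 1ℚ * a + b) Δ-shape₄
           (cong₂ (λ a b → - 1ℚ * a + b) Δ-shape₅ (cong (λ a → 1ℚ * a + 0ℚ) Δ-shape₆))))) ⟩
    1ℚ * (h₁ + (graftedV + (graftedU + c₁))) + (- 1ℚ * (h₂ + (graftedU + c₂))
      + (- 1ℚ * (h₃ + (graftedV + c₃)) + (1ℚ * (h₄ + (trunk + c₄))
      + (- 1ℚ * (h₅ + (bulletGrafted + (trunk + c₅))) + (1ℚ * (h₆ + (bulletGrafted + c₆)) + 0ℚ)))))
      ≡⟨ solve 16 (λ h₁ h₂ h₃ h₄ h₅ h₆ a b t m c₁ c₂ c₃ c₄ c₅ c₆ →
           con 1ℚ :* (h₁ :+ (a :+ (b :+ c₁))) :+ (con (- 1ℚ) :* (h₂ :+ (b :+ c₂))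
             :+ (con (- 1ℚ) :* (h₃ :+ (a :+ c₃)) :+ (con 1ℚ :* (h₄ :+ (t :+ c₄))
             :+ (con (- 1ℚ) :* (h₅ :+ (m :+ (t :+ c₅))) :+ (con 1ℚ :* (h₆ :+ (m :+ c₆)) :+ con 0ℚ)))))
           := (con 1ℚ :* h₁ :+ (con (- 1ℚ) :* h₂ :+ (con (- 1ℚ) :* h₃ :+ (con 1ℚ :* h₄
                :+ (con (- 1ℚ) :* h₅ :+ (con 1ℚ :* h₆ :+ con 0ℚ))))))
              :+ (con 1ℚ :* c₁ :+ (con (- 1ℚ) :* c₂ :+ (con (- 1ℚ) :* c₃ :+ (con 1ℚ :* c₄
                :+ (con (- 1ℚ) :* c₅ :+ (con 1ℚ :* c₆ :+ con 0ℚ)))))))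
           refl h₁ h₂ h₃ h₄ h₅ h₆ graftedV graftedU trunk bulletGrafted c₁ c₂ c₃ c₄ c₅ c₆ ⟩
    ⟦ sixTerm U V ⟧ (λ E → h (E , 𝕀)) + ⟦ sixShapes ⟧ cross
      ≡⟨ cong (⟦ sixTerm U V ⟧ (λ E → h (E , 𝕀)) +_)
              (trans (⟦⟧-∑ sixShapes (ΔF U) (λ x S → cross-term S x))
                     (∑-cong (ΔF U) (λ x → ⟦⟧-∑ sixShapes (ΔF V)
                                                 (λ y S → h (proj₁ x ⊗F proj₁ y , S (proj₂ x) (proj₂ y)))))) ⟩
    ⟦ sixTerm U V ⟧ (λ E → h (E , 𝕀))
      + ∑ (ΔF U) (λ x → ∑ (ΔF V) (λ y → ⟦ sixTerm (proj₂ x) (proj₂ y) ⟧ (λ E → h (proj₁ x ⊗F proj₁ y , E)))) ∎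
    where
    h₁ h₂ h₃ h₄ h₅ h₆ c₁ c₂ c₃ c₄ c₅ c₆ : ℚ
    h₁ = h (shape₁ U V , 𝕀)
    h₂ = h (shape₂ U V , 𝕀)
    h₃ = h (shape₃ U V , 𝕀)
    h₄ = h (shape₄ U V , 𝕀)
    h₅ = h (shape₅ U V , 𝕀)
    h₆ = h (shape₆ U V , 𝕀)
    c₁ = cross shape₁
    c₂ = cross shape₂
    c₃ = cross shape₃
    c₄ = cross shape₄
    c₅ = cross shape₅
    c₆ = cross shape₆

ρ-Vanishes : ℋ → Set
ρ-Vanishes h = ∀ rw G → ⟦ h ⟧ (λ f → ⟦ revWordImage f rw ⟧ G) ≡ 0ℚ

sixTerm-ρ-vanishes : ∀ {U} → TreeOrEmpty U → ∀ V → ρ-Vanishes (sixTerm U V)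
sixTerm-ρ-vanishes U-tree V [] G = refl
sixTerm-ρ-vanishes {U} U-tree V (v ∷ r) G = begin
  ⟦ sixTerm U V ⟧ (λ E → ⟦ revWordImage E (v ∷ r) ⟧ G)
    ≡⟨ ⟦⟧-cong (sixTerm U V) (λ E → revWordImage-∷ E v r G) ⟩
  ⟦ sixTerm U V ⟧ (λ E → ∑ (ΔF E) term)
    ≡⟨ Δ-sixTerm U V term ⟩
  ⟦ sixTerm U V ⟧ (λ E → term (E , 𝕀))
    + ∑ (ΔF U) (λ x → ∑ (ΔF V) (λ y → ⟦ sixTerm (proj₂ x) (proj₂ y) ⟧ (λ E → term (proj₁ x ⊗F proj₁ y , E))))
    ≡⟨ cong₂ _+_ appended (∑-zero-All (λ {x} → cross x) (ΔF-TreeOrEmpty U-tree)) ⟩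
  0ℚ + 0ℚ
    ≡⟨ ℚ.+-identityʳ 0ℚ ⟩
  0ℚ ∎
  where
  term : Forest × Forest → ℚ
  term x = ⟦ revWordImage (proj₁ x) r *P letterImage (proj₂ x) v ⟧ G
  appended : ⟦ sixTerm U V ⟧ (λ E → term (E , 𝕀)) ≡ 0ℚ
  appended = trans (⟦⟧-cong (sixTerm U V) (λ E → ⟦⟧-*P-letter (revWordImage E r) v G))
                   (sixTerm-ρ-vanishes U-tree V r (G ◂ [ v ]))
  cross : ∀ x → TreeOrEmpty (proj₂ x) →
          ∑ (ΔF V) (λ y → ⟦ sixTerm (proj₂ x) (proj₂ y) ⟧ (λ E → term (proj₁ x ⊗F proj₁ y , E))) ≡ 0ℚ
  cross (a , b) b-tree = ∑-zero (ΔF V) λ y → begin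
    ⟦ sixTerm b (proj₂ y) ⟧ (λ E → term (a ⊗F proj₁ y , E))
      ≡⟨ ⟦⟧-cong (sixTerm b (proj₂ y)) (λ E → ⟦⟧-*P (revWordImage (a ⊗F proj₁ y) r) (letterImage E v) G) ⟩
    ⟦ sixTerm b (proj₂ y) ⟧ (λ E → ⟦ revWordImage (a ⊗F proj₁ y) r ⟧ (λ s → ⟦ letterImage E v ⟧ (s ▸ G)))
      ≡⟨ ⟦⟧-comm (sixTerm b (proj₂ y)) (revWordImage (a ⊗F proj₁ y) r) (λ E s → ⟦ letterImage E v ⟧ (s ▸ G)) ⟩
    ⟦ revWordImage (a ⊗F proj₁ y) r ⟧ (λ s → ⟦ sixTerm b (proj₂ y) ⟧ (λ E → ⟦ letterImage E v ⟧ (s ▸ G)))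
      ≡⟨ ⟦⟧-vanishes (revWordImage (a ⊗F proj₁ y) r) (λ s → sixTerm-letter b-tree (proj₂ y) v (s ▸ G)) ⟩
    0ℚ ∎

graft : ℋ → ℋ
graft = map (λ x → (proj₁ x , B₊ (proj₂ x) · 𝕀))

ρ-vanishes-graft : ∀ h → ρ-Vanishes h → ρ-Vanishes (graft h)
ρ-vanishes-graft h ρh rw G = trans (∑-map _ h _) (grafted-vanishes rw G)
  where
  grafted-vanishes : ∀ rw G → ⟦ h ⟧ (λ f → ⟦ revWordImage (B₊ f · 𝕀) rw ⟧ G) ≡ 0ℚ
  grafted-vanishes [] G = ∑-zero h (λ x → ℚ.*-zeroʳ (proj₁ x))
  grafted-vanishes (v ∷ r) G = begin
    ⟦ h ⟧ (λ f → ⟦ revWordImage (B₊ f · 𝕀) (v ∷ r) ⟧ G)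
      ≡⟨ ⟦⟧-cong h (λ f → revWordImage-B₊ f v r G) ⟩
    ⟦ h ⟧ (grafted ⊕ sign v ⊛ inner)
      ≡⟨ ⟦⟧-⊕ h grafted (sign v ⊛ inner) ⟩
    ⟦ h ⟧ grafted + ⟦ h ⟧ (sign v ⊛ inner)
      ≡⟨ cong₂ _+_ (grafted-vanishes r (G ◂ [ v ]))
                   (trans (⟦⟧-⊛ h (sign v) inner) (cong (sign v *_) (ρh (X ∷ r) (ψᵀ G)))) ⟩
    0ℚ + sign v * 0ℚ
      ≡⟨ solve 1 (λ s → con 0ℚ :+ s :* con 0ℚ := con 0ℚ) refl (sign v) ⟩
    0ℚ ∎
    where
    grafted inner : Forest → ℚ
    grafted f = ⟦ revWordImage (B₊ f · 𝕀) r ⟧ (G ◂ [ v ])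
    inner f = ⟦ revWordImage f (X ∷ r) ⟧ (ψᵀ G)

B₊^ℋ : ℕ → ℋ → ℋ
B₊^ℋ k = map (λ x → (proj₁ x , B₊^ k (proj₂ x)))

ρ-vanishes-B₊^ : ∀ k h → ρ-Vanishes h → ρ-Vanishes (B₊^ℋ k h)
ρ-vanishes-B₊^ zero h ρh rw G = trans (∑-map _ h _) (ρh rw G)
ρ-vanishes-B₊^ (suc k) h ρh rw G =
  trans (trans (∑-map _ h _) (sym (trans (∑-map _ (B₊^ℋ k h) _) (∑-map _ h _))))
        (ρ-vanishes-graft (B₊^ℋ k h) (ρ-vanishes-B₊^ k h ρh) rw G)

⟦ρ⟧ : ∀ h p G → ⟦ ρ h p ⟧ G ≡ ⟦ h ⟧ (λ f → ⟦ forestMap f p ⟧ G)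
⟦ρ⟧ [] p G = refl
⟦ρ⟧ ((c , f) ∷ h) p G =
  trans (⟦⟧-++ (scaleP c (forestMap f p)) (ρ h p) G) (cong₂ _+_ (⟦⟧-scaleP c (forestMap f p) G) (⟦ρ⟧ h p G))

ρ-vanishes⇒⟦⟧-forestMap≡0 : ∀ h → ρ-Vanishes h → ∀ p G → ⟦ h ⟧ (λ f → ⟦ forestMap f p ⟧ G) ≡ 0ℚ
ρ-vanishes⇒⟦⟧-forestMap≡0 h ρh p G = begin
  ⟦ h ⟧ (λ f → ⟦ forestMap f p ⟧ G)
    ≡⟨ ⟦⟧-cong h (λ f → trans (cong (λ q → ⟦ q ⟧ G) (forestMap≡image f p)) (⟦⟧-image f p G)) ⟩
  ⟦ h ⟧ (λ f → ⟦ p ⟧ (dual f G))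
    ≡⟨ ⟦⟧-comm h p (λ f → dual f G) ⟩
  ⟦ p ⟧ (λ w → ⟦ h ⟧ (λ f → dual f G w))
    ≡⟨ ⟦⟧-vanishes p (λ w → ρh (reverse w) G) ⟩
  0ℚ ∎

-- Telescoping f[ m , n ]

∑² : ℕ → ℕ → (ℕ → ℕ → ℚ) → ℚ
∑² m n g = ∑ (upTo m) (λ i → ∑ (upTo n) (g i))

∑²-- : ∀ m n (f g : ℕ → ℕ → ℚ) → ∑² m n (λ i j → f i j - g i j) ≡ ∑² m n f - ∑² m n g
∑²-- m n f g = trans (∑-cong (upTo m) (λ i → ∑-- (upTo n) (f i) (g i))) (∑-- (upTo m) _ _)

∑²-* : ∀ m n a (f : ℕ → ℕ → ℚ) → ∑² m n (λ i j → a * f i j) ≡ a * ∑² m n f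
∑²-* m n a f = trans (∑-cong (upTo m) (λ i → ∑-* (upTo n) a (f i))) (∑-* (upTo m) a _)

∑-upTo-suc : ∀ m (f : ℕ → ℚ) → ∑ (upTo (suc m)) f ≡ ∑ (upTo m) f + f m
∑-upTo-suc m f = trans (cong (λ xs → ∑ xs f) (sym (List.upTo-∷ʳ m)))
                       (trans (∑-++ (upTo m) [ m ] f) (cong (∑ (upTo m) f +_) (ℚ.+-identityʳ (f m))))

∑-cong-upTo : ∀ m {f g : ℕ → ℚ} → (∀ {i} → i < m → f i ≡ g i) → ∑ (upTo m) f ≡ ∑ (upTo m) g
∑-cong-upTo m f≡g = ∑-cong-All f≡g (all-upTo m)

∑²-origin : ∀ m n (g : ℕ → ℕ → ℚ) →
            ∑² (suc m) (suc n) (λ i j → if (i ≡ᵇ 0) ∧ (j ≡ᵇ 0) then g i j else 0ℚ) ≡ g 0 0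
∑²-origin m n g =
  trans (cong₂ (λ a b → (g 0 0 + a) + b)
               (∑-zero-All (λ e → e) (applyUpTo⁺₂ _ n (λ i → refl)))
               (∑-zero-All (λ e → e) (applyUpTo⁺₂ _ m (λ i → ∑-zero (upTo (suc n)) (λ j → refl)))))
        (trans (ℚ.+-identityʳ _) (ℚ.+-identityʳ (g 0 0)))

⟦if⟧ : ∀ b y (V : Forest → ℚ) → ⟦ if b then [] else y ∷ [] ⟧ V ≡ ⟦ y ∷ [] ⟧ V - (if b then ⟦ y ∷ [] ⟧ V else 0ℚ)
⟦if⟧ true y V = sym (ℚ.+-inverseʳ (⟦ y ∷ [] ⟧ V))
⟦if⟧ false y V = sym (ℚ.+-identityʳ (⟦ y ∷ [] ⟧ V))

∸-suc : ∀ {i m} → i < m → m ∸ i ≡ suc (m ∸ suc i)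
∸-suc {i} {suc m} (s≤s i≤m) = ℕ.+-∸-assoc 1 i≤m

B₊^-B₊ : ∀ k f → B₊^ k (B₊ f · 𝕀) ≡ B₊^ (suc k) f
B₊^-B₊ zero f = refl
B₊^-B₊ (suc k) f = cong (λ g → B₊ g · 𝕀) (B₊^-B₊ k f)

B₊^-L : ∀ k i → B₊^ k (L i) ≡ L (k +ℕ i)
B₊^-L zero i = refl
B₊^-L (suc k) i = cong (λ g → B₊ g · 𝕀) (B₊^-L k i)

module Telescoping (V : Forest → ℚ)
                   (sixTerm-vanishes : ∀ k i j → ⟦ sixTerm (L i) (L j) ⟧ (λ f → V (B₊^ k f)) ≡ 0ℚ) where

  P grafted-bullet bullet defect : ℕ → ℕ → ℕ → ℚ
  P k i j = V (B₊^ k (L i ⊗F L j))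
  grafted-bullet k i j = V (B₊^ k (● · B₊ (L i ⊗F L j) · 𝕀))
  bullet k i j = V (B₊^ k (● · (L i ⊗F L j)))
  defect k i j = grafted-bullet k i j - bullet (suc k) i j

  P-ladder : ∀ k i → P k i 0 ≡ V (L (k +ℕ i))
  P-ladder k i = cong V (trans (cong (B₊^ k) (⊗F-identityʳ (L i))) (B₊^-L k i))

  defect-as-difference : ∀ k i j → defect k i j ≡
    P k (suc i) (suc j) - P (suc k) i (suc j) - P (suc k) (suc i) j + P (suc (suc k)) i j
  defect-as-difference k i j = begin
    e - bullet (suc k) i j
      ≡⟨ cong (λ z → e - z) (cong V (B₊^-B₊ k (● · (L i ⊗F L j)))) ⟨
    e - f
      ≡⟨ solve 6 (λ a b c d e f → e :- f := (a :- b :- c :+ d)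
                   :- (con 1ℚ :* a :+ (con (- 1ℚ) :* b :+ (con (- 1ℚ) :* c :+ (con 1ℚ :* d
                   :+ (con (- 1ℚ) :* e :+ (con 1ℚ :* f :+ con 0ℚ)))))))
                 refl (P k (suc i) (suc j)) b c d e f ⟩
    (P k (suc i) (suc j) - b - c + d) - ⟦ sixTerm (L i) (L j) ⟧ (λ f → V (B₊^ k f))
      ≡⟨ cong₂ (λ x y → x - y)
               (cong₂ (λ x y → x + y) (cong₂ (λ x y → P k (suc i) (suc j) - x - y) b≡ c≡) d≡)
               (sixTerm-vanishes k i j) ⟩
    (P k (suc i) (suc j) - P (suc k) i (suc j) - P (suc k) (suc i) j + P (suc (suc k)) i j) - 0ℚ
      ≡⟨ ℚ.+-identityʳ _ ⟩
    P k (suc i) (suc j) - P (suc k) i (suc j) - P (suc k) (suc i) j + P (suc (suc k)) i j ∎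
    where
    b c d e f : ℚ
    b = V (B₊^ k (B₊ (L i ⊗F L (suc j)) · 𝕀))
    c = V (B₊^ k (B₊ (B₊ (L i) · L j) · 𝕀))
    d = V (B₊^ k (B₊ (B₊ (L i ⊗F L j) · 𝕀) · 𝕀))
    e = grafted-bullet k i j
    f = V (B₊^ k (B₊ (● · (L i ⊗F L j)) · 𝕀))
    b≡ : b ≡ P (suc k) i (suc j)
    b≡ = cong V (B₊^-B₊ k (L i ⊗F L (suc j)))
    c≡ : c ≡ P (suc k) (suc i) j
    c≡ = cong V (B₊^-B₊ k (B₊ (L i) · L j))
    d≡ : d ≡ P (suc (suc k)) i j
    d≡ = cong V (trans (B₊^-B₊ k (B₊ (L i ⊗F L j) · 𝕀)) (B₊^-B₊ (suc k) (L i ⊗F L j)))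

  row-sum : ∀ n k i → ∑ (upTo n) (λ j → defect (k +ℕ (n ∸ suc j)) i j) ≡ P k (suc i) n - P (suc k) i n
  row-sum zero k i rewrite P-ladder k (suc i) | P-ladder (suc k) i | ℕ.+-suc k i =
    sym (ℚ.+-inverseʳ (V (L (suc (k +ℕ i)))))
  row-sum (suc n) k i = begin
    ∑ (upTo (suc n)) (λ j → defect (k +ℕ (suc n ∸ suc j)) i j)
      ≡⟨ ∑-upTo-suc n _ ⟩
    ∑ (upTo n) (λ j → defect (k +ℕ (n ∸ j)) i j) + defect (k +ℕ (n ∸ n)) i n
      ≡⟨ cong₂ _+_ (∑-cong-upTo n (λ {j} j<n → cong (λ e → defect e i j)
                                     (trans (cong (k +ℕ_) (∸-suc j<n)) (ℕ.+-suc k _))))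
                   (cong (λ e → defect e i n) (trans (cong (k +ℕ_) (ℕ.n∸n≡0 n)) (ℕ.+-identityʳ k))) ⟩
    ∑ (upTo n) (λ j → defect (suc k +ℕ (n ∸ suc j)) i j) + defect k i n
      ≡⟨ cong₂ _+_ (row-sum n (suc k) i) (defect-as-difference k i n) ⟩
    (P (suc k) (suc i) n - P (suc (suc k)) i n)
      + (P k (suc i) (suc n) - P (suc k) i (suc n) - P (suc k) (suc i) n + P (suc (suc k)) i n)
      ≡⟨ solve 4 (λ a b c d → (a :- b) :+ (c :- d :- a :+ b) := c :- d) refl
                 (P (suc k) (suc i) n) (P (suc (suc k)) i n) (P k (suc i) (suc n)) (P (suc k) i (suc n)) ⟩
    P k (suc i) (suc n) - P (suc k) i (suc n) ∎

  grid-sum : ∀ m k n → ∑² m n (λ i j → defect (k +ℕ ((m ∸ suc i) +ℕ (n ∸ suc j))) i j) ≡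
                       P k m n - V (L (k +ℕ (m +ℕ n)))
  grid-sum zero k n = sym (trans (cong (_- V (L (k +ℕ n))) (cong V (B₊^-L k n))) (ℚ.+-inverseʳ (V (L (k +ℕ n)))))
  grid-sum (suc m) k n = begin
    ∑² (suc m) n (λ i j → defect (k +ℕ ((suc m ∸ suc i) +ℕ (n ∸ suc j))) i j)
      ≡⟨ ∑-upTo-suc m _ ⟩
    ∑² m n (λ i j → defect (k +ℕ ((m ∸ i) +ℕ (n ∸ suc j))) i j)
      + ∑ (upTo n) (λ j → defect (k +ℕ ((m ∸ m) +ℕ (n ∸ suc j))) m j)
      ≡⟨ cong₂ _+_ (∑-cong-upTo m (λ {i} i<m → ∑-cong (upTo n) (λ j → cong (λ e → defect e i j)
                     (trans (cong (λ a → k +ℕ (a +ℕ (n ∸ suc j))) (∸-suc i<m)) (ℕ.+-suc k _)))))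
                   (∑-cong (upTo n) (λ j → cong (λ a → defect (k +ℕ (a +ℕ (n ∸ suc j))) m j) (ℕ.n∸n≡0 m))) ⟩
    ∑² m n (λ i j → defect (suc k +ℕ ((m ∸ suc i) +ℕ (n ∸ suc j))) i j)
      + ∑ (upTo n) (λ j → defect (k +ℕ (n ∸ suc j)) m j)
      ≡⟨ cong₂ _+_ (grid-sum m (suc k) n) (row-sum n k m) ⟩
    (P (suc k) m n - V (L (suc k +ℕ (m +ℕ n)))) + (P k (suc m) n - P (suc k) m n)
      ≡⟨ cong (λ e → (P (suc k) m n - V (L e)) + (P k (suc m) n - P (suc k) m n)) (sym (ℕ.+-suc k (m +ℕ n))) ⟩
    (P (suc k) m n - V (L (k +ℕ suc (m +ℕ n)))) + (P k (suc m) n - P (suc k) m n)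
      ≡⟨ solve 3 (λ a b c → (a :- b) :+ (c :- a) := c :- b) refl
                 (P (suc k) m n) (V (L (k +ℕ suc (m +ℕ n)))) (P k (suc m) n) ⟩
    P k (suc m) n - V (L (k +ℕ (suc m +ℕ n))) ∎

  module _ (m n : ℕ) where
    private
      M N : ℕ
      M = suc m
      N = suc n

      κ : ℕ → ℕ → ℕ
      κ i j = (M ∸ suc i) +ℕ (N ∸ suc j)

      exponent-∸2 : ∀ {i j} → i < M → j < N → (M ∸ i) +ℕ (N ∸ j) ∸ 2 ≡ κ i j
      exponent-∸2 {i} {j} i<M j<N rewrite ∸-suc i<M | ∸-suc j<N = cong (_∸ 1) (ℕ.+-suc (M ∸ suc i) (N ∸ suc j))

      exponent-∸1 : ∀ {i j} → i < M → j < N → (M ∸ i) +ℕ (N ∸ j) ∸ 1 ≡ suc (κ i j)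
      exponent-∸1 {i} {j} i<M j<N rewrite ∸-suc i<M | ∸-suc j<N = ℕ.+-suc (M ∸ suc i) (N ∸ suc j)

      grafted-term bullet-term : ℕ → ℕ → ℚ × Forest
      grafted-term i j = (- 1ℚ , B₊^ ((M ∸ i) +ℕ (N ∸ j) ∸ 2) (● · B₊ (L i ⊗F L j) · 𝕀))
      bullet-term i j = (1ℚ , B₊^ ((M ∸ i) +ℕ (N ∸ j) ∸ 1) (● · (L i ⊗F L j)))

      bullet-row : ℕ → ℋ
      bullet-row i = concatMap (λ j → if (i ≡ᵇ 0) ∧ (j ≡ᵇ 0) then [] else bullet-term i j ∷ []) (upTo N)

      grafted-terms bullet-terms : ℋ
      grafted-terms = concatMap (λ i → map (grafted-term i) (upTo N)) (upTo M)
      bullet-terms = concatMap bullet-row (upTo M)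

      Vx : ℚ × Forest → ℚ
      Vx x = proj₁ x * V (proj₂ x)

      bullet-value : ℕ → ℕ → ℚ
      bullet-value i j = ⟦ bullet-term i j ∷ [] ⟧ V

      grafted-sum : ⟦ grafted-terms ⟧ V ≡ ∑² M N (λ i j → - 1ℚ * grafted-bullet (κ i j) i j)
      grafted-sum = trans (∑-concatMap (λ i → map (grafted-term i) (upTo N)) (upTo M) Vx) (∑-cong-upTo M (λ {i} i<M →
        trans (∑-map (grafted-term i) (upTo N) Vx) (∑-cong-upTo N (λ {j} j<N →
          cong (λ e → - 1ℚ * V (B₊^ e (● · B₊ (L i ⊗F L j) · 𝕀))) (exponent-∸2 i<M j<N)))))

      bullet-sum : ⟦ bullet-terms ⟧ V ≡ ∑² M N (λ i j → bullet (suc (κ i j)) i j) - V (L (M +ℕ N))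
      bullet-sum = begin
        ⟦ bullet-terms ⟧ V
          ≡⟨ trans (∑-concatMap bullet-row (upTo M) Vx)
                   (∑-cong (upTo M) (λ i → ∑-concatMap (λ j → if (i ≡ᵇ 0) ∧ (j ≡ᵇ 0) then [] else bullet-term i j ∷ [])
                                                       (upTo N) Vx)) ⟩
        ∑² M N (λ i j → ⟦ if (i ≡ᵇ 0) ∧ (j ≡ᵇ 0) then [] else bullet-term i j ∷ [] ⟧ V)
          ≡⟨ ∑-cong (upTo M) (λ i → ∑-cong (upTo N) (λ j → ⟦if⟧ ((i ≡ᵇ 0) ∧ (j ≡ᵇ 0)) (bullet-term i j) V)) ⟩
        ∑² M N (λ i j → bullet-value i j - (if (i ≡ᵇ 0) ∧ (j ≡ᵇ 0) then bullet-value i j else 0ℚ))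
          ≡⟨ ∑²-- M N bullet-value (λ i j → if (i ≡ᵇ 0) ∧ (j ≡ᵇ 0) then bullet-value i j else 0ℚ) ⟩
        ∑² M N bullet-value - ∑² M N (λ i j → if (i ≡ᵇ 0) ∧ (j ≡ᵇ 0) then bullet-value i j else 0ℚ)
          ≡⟨ cong₂ _-_ (∑-cong-upTo M (λ i<M → ∑-cong-upTo N (λ j<N → reindex i<M j<N))) (∑²-origin m n bullet-value) ⟩
        ∑² M N (λ i j → bullet (suc (κ i j)) i j) - bullet-value 0 0
          ≡⟨ cong (λ z → ∑² M N (λ i j → bullet (suc (κ i j)) i j) - z) origin ⟩
        ∑² M N (λ i j → bullet (suc (κ i j)) i j) - V (L (M +ℕ N)) ∎
        where
        reindex : ∀ {i j} → i < M → j < N → bullet-value i j ≡ bullet (suc (κ i j)) i j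
        reindex {i} {j} i<M j<N = trans (trans (ℚ.+-identityʳ _) (ℚ.*-identityˡ _))
          (cong (λ e → V (B₊^ e (● · (L i ⊗F L j)))) (exponent-∸1 i<M j<N))
        origin : bullet-value 0 0 ≡ V (L (M +ℕ N))
        origin = trans (trans (ℚ.+-identityʳ _) (ℚ.*-identityˡ _))
                       (cong V (trans (B₊^-L (m +ℕ N) 1) (cong L (ℕ.+-comm (m +ℕ N) 1))))

    f-vanishes : ⟦ f[ M , N ] ⟧ V ≡ 0ℚ
    f-vanishes = begin
      ⟦ f[ M , N ] ⟧ V
        ≡⟨ cong (1ℚ * P 0 M N +_) (⟦⟧-++ grafted-terms bullet-terms V) ⟩
      1ℚ * P 0 M N + (⟦ grafted-terms ⟧ V + ⟦ bullet-terms ⟧ V)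
        ≡⟨ cong₂ (λ a b → 1ℚ * P 0 M N + (a + b)) grafted-sum bullet-sum ⟩
      1ℚ * P 0 M N + (∑² M N (λ i j → - 1ℚ * grafted-bullet (κ i j) i j)
                      + (∑² M N (λ i j → bullet (suc (κ i j)) i j) - V (L (M +ℕ N))))
        ≡⟨ cong (λ z → 1ℚ * P 0 M N + (z + (∑² M N (λ i j → bullet (suc (κ i j)) i j) - V (L (M +ℕ N)))))
                (∑²-* M N (- 1ℚ) (λ i j → grafted-bullet (κ i j) i j)) ⟩
      1ℚ * P 0 M N + (- 1ℚ * ∑² M N (λ i j → grafted-bullet (κ i j) i j)
                      + (∑² M N (λ i j → bullet (suc (κ i j)) i j) - V (L (M +ℕ N))))
        ≡⟨ solve 4 (λ p g b l → con 1ℚ :* p :+ (con (- 1ℚ) :* g :+ (b :- l)) := p :- (g :- b) :- l) refl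
                   (P 0 M N) (∑² M N (λ i j → grafted-bullet (κ i j) i j))
                   (∑² M N (λ i j → bullet (suc (κ i j)) i j)) (V (L (M +ℕ N))) ⟩
      P 0 M N - (∑² M N (λ i j → grafted-bullet (κ i j) i j) - ∑² M N (λ i j → bullet (suc (κ i j)) i j))
        - V (L (M +ℕ N))
        ≡⟨ cong (λ z → P 0 M N - z - V (L (M +ℕ N)))
                (trans (sym (∑²-- M N (λ i j → grafted-bullet (κ i j) i j) (λ i j → bullet (suc (κ i j)) i j)))
                       (grid-sum M 0 N)) ⟩
      P 0 M N - (P 0 M N - V (L (M +ℕ N))) - V (L (M +ℕ N))
        ≡⟨ solve 2 (λ p l → p :- (p :- l) :- l := con 0ℚ) refl (P 0 M N) (V (L (M +ℕ N))) ⟩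
      0ℚ ∎

ladder-treeOrEmpty : ∀ i → TreeOrEmpty (L i)
ladder-treeOrEmpty zero = empty
ladder-treeOrEmpty (suc i) = tree (B₊ (L i))

theorem3p2 : (m n : ℕ) → 1 ≤ m → 1 ≤ n → (p : Poly) → IsZero (ρ f[ m , n ] p)
theorem3p2 (suc m) (suc n) _ _ p = isZero-if-⟦⟧≡0 (ρ f[ suc m , suc n ] p) λ G →
  trans (⟦ρ⟧ f[ suc m , suc n ] p G)
        (Telescoping.f-vanishes (λ f → ⟦ forestMap f p ⟧ G) (sixTerms-vanish G) m n)
  where
  sixTerms-vanish : ∀ G k i j → ⟦ sixTerm (L i) (L j) ⟧ (λ f → ⟦ forestMap (B₊^ k f) p ⟧ G) ≡ 0ℚ
  sixTerms-vanish G k i j =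
    trans (sym (∑-map (λ x → (proj₁ x , B₊^ k (proj₂ x))) (sixTerm (L i) (L j))
                      (λ x → proj₁ x * ⟦ forestMap (proj₂ x) p ⟧ G)))
          (ρ-vanishes⇒⟦⟧-forestMap≡0 (B₊^ℋ k (sixTerm (L i) (L j)))
             (ρ-vanishes-B₊^ k (sixTerm (L i) (L j)) (sixTerm-ρ-vanishes (ladder-treeOrEmpty i) (L j))) p G)
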